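{- For every rational $t$ with $0<t<1$, let $\tilde m^t_q$ be the top right entry of the matrix $C_t$, where $C_{0/1}=A(1)_q$, $C_{1/1}=B(1)_q$, and $C_{\frac{r+r'}{s+s'}}=C_{r/s}C_{r'/s'}$ for Farey neighbours $\frac rs<\frac{r'}{s'}$ in $[0,1]$. Then $\tilde m^t_q$ equals the weighted number of perfect matchings $\sum_{\mathfrak m}\mathrm{wt}(\mathfrak m)$ of the weighted graph $\tilde{\mathcal G}_t(q)$, obtained from $\mathcal{G}_t(q)$ by replacing the weight $q$ of its first horizontal edge (the bottom edge of the first box) by $1$; here $\mathrm{wt}(\mathfrak m)$ is the product of weights of the edges in the perfect matching $\mathfrak m$.
   Context: Let $q$ be a formal variable. $A(1)_q=\begin{pmatrix} q&1\\ q& q^{ -1}(1+q)\end{pmatrix}$ and $B(1)_q=\begin{pmatrix} q^2+q+1& q^{ -1}(1+q)\\ q^{ -1}(1+q+q^2+q^3) & q^{ -2}(1+q+q^2)\end{pmatrix}$. Two rationals $\frac{r}{s}<\frac{r'}{s'}$ in $[0,1]$, written in lowest terms with $s,s'>0$, are Farey neighbours if $r's-rs'=1$; every rational in $(0,1)$ is the mediant $\frac{r+r'}{s+s'}$ of exactly one such pair. Christoffel words: for $t=\frac ks$ in lowest terms, let $N=k+s$ and $w_t=x_1\cdots x_N$ with $x_i=X$ if $\lfloor ik/N\rfloor=\lfloor (i-1)k/N\rfloor$ and $x_i=Y$ otherwise. Rewriting $w_t$ in the letters $A=X$, $B=XY$ gives a word $\tilde w_t$ which, for $0<t<1$, has the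 form $A\,w_1\cdots w_s\,B$ with $w_i\in\{A,B\}$. Weighted snake graph $\mathcal{G}_t(q)$, $0<t<1$: made of unit square boxes, unspecified edge weights being $1$. Each letter of $\tilde w_t$ gives a piece: the initial $A$ gives two boxes side by side with bottom edges of weights $q$ (left) and $q^{ -1}$ (right) and left edge of weight $q^{ -1}$; every other $A$ gives two boxes side by side with bottom weights $q,q^{ -1}$; every non-final $B$ gives a column of three boxes plus one box to the right of the top box, with the bottom edge of the bottom box of weight $q$, the left edge of the middle box of weight $q$, the left edge of the top box of weight $q^{ -1}$, and the bottom edge of the right box of weight $q^{ -1}$; the final $B$ gives a single box with bottom edge of weight $q$. Pieces are glued in order, identifying the rightmost vertical edge of each piece with the left vertical edge of the bottom-left box of the next piece (weight $1$). A perfect matching is a set of edges such that every vertex is incident to exactly one of them. -}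

module Defs where

open import Data.Nat using (ℕ; zero; suc; _+_; _*_; _∸_; _⊔_; _<_; _≤_; _≡ᵇ_; NonZero)
open import Data.Nat.DivMod using (_/_)
open import Data.Integer as ℤ using (ℤ; +_; -[1+_])
open import Data.Bool using (Bool; true; false; _∨_; _∧_; if_then_else_)
open import Data.List using (List; []; _∷_; _++_; map; foldr; replicate; length; filter; upTo)
open import Data.List.Relation.Unary.All using (All; all?)
open import Data.Product using (_×_; _,_)
open import Data.Nat using (_≟_)
import Data.Bool as B
open import Relation.Binary.PropositionalEquality using (_≡_)
open import Relation.Nullary using (Dec; does)

-- Laurent polynomials in q with natural-number coefficients.
-- lp s cs  represents  q^(-s) * Σ_i cs[i] q^i .
-- (All quantities in the statement have nonnegative coefficients, and
-- ℕ[q,q⁻¹] ⊆ ℤ[q,q⁻¹], so equality here is equality of Laurent polynomials.)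

record LP : Set where
  constructor lp
  field
    shift : ℕ
    cs    : List ℕ

lookupD : List ℕ → ℕ → ℕ
lookupD []       _       = 0
lookupD (c ∷ cs) zero    = c
lookupD (c ∷ cs) (suc n) = lookupD cs n

coeff : LP → ℤ → ℕ
coeff (lp s cs) n with n ℤ.+ (+ s)
... | + m      = lookupD cs m
... | -[1+ _ ] = 0

infix 4 _≈_
_≈_ : LP → LP → Set
p ≈ p' = (n : ℤ) → coeff p n ≡ coeff p' n

addL : List ℕ → List ℕ → List ℕ
addL []       ys       = ys
addL xs       []       = xs
addL (x ∷ xs) (y ∷ ys) = (x + y) ∷ addL xs ys

mulL : List ℕ → List ℕ → List ℕ
mulL []       ys = []
mulL (x ∷ xs) ys = addL (map (x *_) ys) (0 ∷ mulL xs ys)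

infixl 6 _⊕_
infixl 7 _⊛_

_⊕_ : LP → LP → LP
lp s c ⊕ lp s' c' =
  lp (s ⊔ s') (addL (replicate ((s ⊔ s') ∸ s) 0 ++ c) (replicate ((s ⊔ s') ∸ s') 0 ++ c'))

_⊛_ : LP → LP → LP
lp s c ⊛ lp s' c' = lp (s + s') (mulL c c')

𝟘 𝟙 qq qinv : LP
𝟘    = lp 0 []
𝟙    = lp 0 (1 ∷ [])
qq   = lp 0 (0 ∷ 1 ∷ [])
qinv = lp 1 (1 ∷ [])

record M2 : Set where
  constructor mat
  field
    m11 m12 m21 m22 : LP

topRight : M2 → LP
topRight = M2.m12

infixl 7 _⊗_
_⊗_ : M2 → M2 → M2
mat a b c d ⊗ mat a' b' c' d' =
  mat (a ⊛ a' ⊕ b ⊛ c') (a ⊛ b' ⊕ b ⊛ d') (c ⊛ a' ⊕ d ⊛ c') (c ⊛ b' ⊕ d ⊛ d')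

infix 4 _≋_
_≋_ : M2 → M2 → Set
mat a b c d ≋ mat a' b' c' d' = (a ≈ a') × (b ≈ b') × (c ≈ c') × (d ≈ d')

-- A(1)_q = [[q, 1], [q, q⁻¹(1+q)]]
A1 : M2
A1 = mat qq 𝟙 qq (lp 1 (1 ∷ 1 ∷ []))

-- B(1)_q = [[q²+q+1, q⁻¹(1+q)], [q⁻¹(1+q+q²+q³), q⁻²(1+q+q²)]]
B1 : M2
B1 = mat (lp 0 (1 ∷ 1 ∷ 1 ∷ [])) (lp 1 (1 ∷ 1 ∷ []))
         (lp 1 (1 ∷ 1 ∷ 1 ∷ 1 ∷ [])) (lp 2 (1 ∷ 1 ∷ 1 ∷ []))

-- Farey neighbours  r/s < r'/s'  in [0,1]  (r' s − r s' = 1; this forces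
-- lowest terms)

FareyNeighbours : ℕ → ℕ → ℕ → ℕ → Set
FareyNeighbours r s r' s' =
  (0 < s) × (0 < s') × (r ≤ s) × (r' ≤ s') × (r' * s ≡ r * s' + 1)

IsCFamily : (ℕ → ℕ → M2) → Set
IsCFamily C =
  (C 0 1 ≋ A1) × (C 1 1 ≋ B1) ×
  (∀ r s r' s' → FareyNeighbours r s r' s' →
     C (r + r') (s + s') ≋ C r s ⊗ C r' s')

data XY : Set where
  X Y : XY

christoffel : ℕ → ℕ → List XY
christoffel k s = go (k + s)
  where
  go : ℕ → List XY
  go zero        = []
  go N@(suc n)   =
    map (λ j → if ((j + 1) * k / N) ≡ᵇ (j * k / N) then X else Y) (upTo N)

data AB : Set where
  A B : AB

toAB : List XY → List AB
toAB []           = []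
toAB (X ∷ Y ∷ ws) = B ∷ toAB ws
toAB (X ∷ ws)     = A ∷ toAB ws
toAB (Y ∷ ws)     = toAB ws   -- never occurs for 0 < t < 1

Vertex : Set
Vertex = ℕ × ℕ

record Edge : Set where
  constructor edge
  field
    end₁ end₂ : Vertex
    wt        : LP

hor ver : ℕ → ℕ → LP → Edge
hor x y w = edge (x , y) (suc x , y) w
ver x y w = edge (x , y) (x , suc y) w

-- left edge of the bottom-left box of a piece: only present for the
-- first piece (otherwise it is identified with the previous right edge)
leftEdge : Bool → ℕ → ℕ → LP → List Edge
leftEdge true  x y w = ver x y w ∷ []
leftEdge false x y w = []

-- piece A: two boxes side by side; bottom weights q, q⁻¹;
-- the initial A also has left edge of weight q⁻¹
pieceA : Bool → ℕ → ℕ → List Edge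
pieceA first x y =
  leftEdge first x y qinv ++
  ( hor x y qq ∷ hor (x + 1) y qinv ∷
    hor x (y + 1) 𝟙 ∷ hor (x + 1) (y + 1) 𝟙 ∷
    ver (x + 1) y 𝟙 ∷ ver (x + 2) y 𝟙 ∷ [] )

-- non-final piece B: column of three boxes plus one box right of the top box
pieceB : Bool → ℕ → ℕ → List Edge
pieceB first x y =
  leftEdge first x y 𝟙 ++
  ( hor x y qq ∷ hor x (y + 1) 𝟙 ∷ hor x (y + 2) 𝟙 ∷ hor x (y + 3) 𝟙 ∷
    ver (x + 1) y 𝟙 ∷ ver (x + 1) (y + 1) 𝟙 ∷ ver (x + 1) (y + 2) 𝟙 ∷
    ver x (y + 1) qq ∷ ver x (y + 2) qinv ∷
    hor (x + 1) (y + 2) qinv ∷ hor (x + 1) (y + 3) 𝟙 ∷ ver (x + 2) (y + 2) 𝟙 ∷ [] )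

-- final piece B: a single box with bottom weight q
finalB : Bool → ℕ → ℕ → List Edge
finalB first x y =
  leftEdge first x y 𝟙 ++
  ( hor x y qq ∷ hor x (y + 1) 𝟙 ∷ ver (x + 1) y 𝟙 ∷ [] )

-- glue the pieces of a word in {A,B}; (x,y) = bottom-left of the next piece
snakeEdges : Bool → ℕ → ℕ → List AB → List Edge
snakeEdges first x y []            = []
snakeEdges first x y (A ∷ ws)      = pieceA first x y ++ snakeEdges false (x + 2) y ws
snakeEdges first x y (B ∷ [])      = finalB first x y
snakeEdges first x y (B ∷ w ∷ ws)  = pieceB first x y ++ snakeEdges false (x + 2) (y + 2) (w ∷ ws)

snakeGraph : ℕ → ℕ → List Edge
snakeGraph k s = snakeEdges true 0 0 (toAB (christoffel k s))

_==ᵥ_ : Vertex → Vertex → Bool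
(a , b) ==ᵥ (c , d) = (a ≡ᵇ c) ∧ (b ≡ᵇ d)

-- 𝒢̃_t(q): the weight of the first horizontal edge (bottom edge of the
-- first box, from (0,0) to (1,0)) is replaced by 1
resetFirst : Edge → Edge
resetFirst (edge u v w) =
  if (u ==ᵥ (0 , 0)) ∧ (v ==ᵥ (1 , 0)) then edge u v 𝟙 else edge u v w

snakeGraphTilde : ℕ → ℕ → List Edge
snakeGraphTilde k s = map resetFirst (snakeGraph k s)

vertices : List Edge → List Vertex
vertices []                 = []
vertices (edge u v _ ∷ es)  = u ∷ v ∷ vertices es

incident : Vertex → Edge → Bool
incident p (edge u v _) = (p ==ᵥ u) ∨ (p ==ᵥ v)

degreeIn : List Edge → Vertex → ℕ
degreeIn S p = length (filter (λ e → incident p e B.≟ true) S)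

subsets : List Edge → List (List Edge)
subsets []       = [] ∷ []
subsets (e ∷ es) = let r = subsets es in map (e ∷_) r ++ r

IsPerfectMatching : List Edge → List Edge → Set
IsPerfectMatching E S = All (λ p → degreeIn S p ≡ 1) (vertices E)

isPerfectMatching? : (E S : List Edge) → Dec (IsPerfectMatching E S)
isPerfectMatching? E S = all? (λ p → degreeIn S p ≟ 1) (vertices E)

weight : List Edge → LP
weight S = foldr (λ e acc → Edge.wt e ⊛ acc) 𝟙 S

matchingSum : List Edge → LP
matchingSum E = foldr _⊕_ 𝟘 (map weight (filter (isPerfectMatching? E) (subsets E)))

-- Christoffel words split along Farey mediants (a floor-division computation driven by the Farey
-- determinant) just as the matrices C_t factor, so by induction over Farey parents C_t is the
-- product of A(1)_q and B(1)_q along the Christoffel word of t.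
-- Cut a snake graph after its first piece. The weighted counts of edge sets with prescribed
-- degrees, in which the two leftmost vertices are both still to be covered or both already
-- covered, obey a linear recursion whose transfer matrix is the transpose Mᵀ of the matrix M of
-- the piece's letter. Since P = q⁻¹ [[1, 1], [1, q⁻¹(1+q)]] satisfies M P = P Mᵀ for both letters,
-- the right column of the word's matrix is P times the vector of counts, and the first piece of
-- the modified graph contributes exactly the first row of A(1)_q P.
module Submission where

open import Defs
open import Data.Nat using (ℕ; _<_)
open import Data.Nat.Coprimality using (Coprime)

open import Data.Nat.Coprimality using (coprime-Bézout)

open import Level using (0ℓ)
open import Data.Nat.Base
  using (zero; suc; _+_; _*_; _∸_; _⊔_; _≤_; z≤n; s≤s; z<s; _≡ᵇ_; NonZero; >-nonZero; _/_; _%_)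
open import Data.Nat.Properties
open import Data.Nat.DivMod
  using (m/n*n≤m; m≡m%n+[m/n]*n; m%n<n; m*n/n≡m; /-monoˡ-≤; m<n*o⇒m/o<n; +-distrib-/-∣ʳ; m<n⇒m/n≡0;
         0/n≡0; %-distribˡ-*; %-distribˡ-+; m%n%n≡m%n; [m+kn]%n≡m%n; m*n%n≡0; m<n⇒m%n≡m)
open import Data.Nat.Divisibility using (_∣_; ∣1⇒≡1; ∣m+n∣m⇒∣n; ∣m⇒∣m*n; ∣-refl; divides)
open import Data.Nat.GCD using (module Bézout)
open import Data.Nat.Induction using (<-rec)
open import Data.Nat.Solver using (module +-*-Solver)
open import Data.Integer.Base as ℤ using (ℤ)
import Data.Integer.Properties as ℤ
open import Data.Bool.Base using (Bool; true; false; _∧_; _∨_; not; if_then_else_; T)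
open import Data.Bool.Properties using (T-∧; T-∨; T-≡)
import Data.Bool as B
open import Data.List.Base using (List; []; _∷_; _++_; map; filter; foldr; length; replicate; drop; applyUpTo)
open import Data.List.Properties using (filter-++; length-++; filter-none; map-∘; map-++; map-upTo)
open import Data.List.Membership.Propositional using (_∈_; _∉_)
open import Data.List.Membership.Propositional.Properties using (∈-++⁻; ∈-map⁺; ∈-map⁻)
open import Data.List.Relation.Unary.Any using (here; there)
open import Data.List.Relation.Unary.All as All using (All; all?)
import Data.List.Relation.Unary.All.Properties as All
open import Data.List.Relation.Binary.Subset.Propositional using (_⊆_)
open import Data.Product.Base using (_×_; _,_; proj₁; proj₂; ∃; ∃₂)
open import Data.Product.Properties using (≡-dec)
open import Data.Sum.Base using (_⊎_; inj₁; inj₂)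
open import Function.Base using (_∘_; flip)
open import Function.Bundles using (_⇔_; mk⇔; Equivalence)
open import Relation.Binary.PropositionalEquality
open import Relation.Binary.Structures using (IsEquivalence)
open import Relation.Binary.Bundles using (Setoid)
import Relation.Binary.Reasoning.Setoid as SetoidReasoning
open import Relation.Nullary using (Dec; does; yes; no; contradiction)
open import Relation.Nullary.Decidable using (True; toWitness; does-⇔; _×-dec_; _⊎-dec_)
open import Algebra.Structures using (IsCommutativeSemiring)
open import Algebra.Structures.Biased using (isCommutativeSemiringˡ)
open import Algebra.Bundles using (CommutativeSemiring)
import Algebra.Solver.Ring.NaturalCoefficients.Default
open import Algebra.Properties.CommutativeSemigroup +-commutativeSemigroup using (x∙yz≈y∙xz)
open import Algebra.Properties.CommutativeSemigroup *-commutativeSemigroup using (xy∙z≈xz∙y)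

-- Coefficient lists and Laurent polynomials

infix 4 _≐_

_≐_ : List ℕ → List ℕ → Set
xs ≐ ys = ∀ i → lookupD xs i ≡ lookupD ys i

lookupD-addL : ∀ xs ys i → lookupD (addL xs ys) i ≡ lookupD xs i + lookupD ys i
lookupD-addL []       ys       i       = refl
lookupD-addL (x ∷ xs) []       i       = sym (+-identityʳ _)
lookupD-addL (x ∷ xs) (y ∷ ys) zero    = refl
lookupD-addL (x ∷ xs) (y ∷ ys) (suc i) = lookupD-addL xs ys i

lookupD-scale : ∀ c ys i → lookupD (map (c *_) ys) i ≡ c * lookupD ys i
lookupD-scale c []       i       = sym (*-zeroʳ c)
lookupD-scale c (y ∷ ys) zero    = refl
lookupD-scale c (y ∷ ys) (suc i) = lookupD-scale c ys i

lookupD-drop1 : ∀ xs i → lookupD (drop 1 xs) i ≡ lookupD xs (suc i)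
lookupD-drop1 []       i = refl
lookupD-drop1 (x ∷ xs) i = refl

lookupD-mulL-zero : ∀ xs ys → lookupD (mulL xs ys) 0 ≡ lookupD xs 0 * lookupD ys 0
lookupD-mulL-zero []       ys = refl
lookupD-mulL-zero (x ∷ xs) ys = begin
  lookupD (addL (map (x *_) ys) (0 ∷ mulL xs ys)) 0 ≡⟨ lookupD-addL (map (x *_) ys) _ 0 ⟩
  lookupD (map (x *_) ys) 0 + 0                     ≡⟨ +-identityʳ _ ⟩
  lookupD (map (x *_) ys) 0                         ≡⟨ lookupD-scale x ys 0 ⟩
  x * lookupD ys 0                                  ∎
  where open ≡-Reasoning

lookupD-mulL-suc : ∀ xs ys i →
  lookupD (mulL xs ys) (suc i) ≡ lookupD xs 0 * lookupD ys (suc i) + lookupD (mulL (drop 1 xs) ys) i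
lookupD-mulL-suc []       ys i = refl
lookupD-mulL-suc (x ∷ xs) ys i =
  trans (lookupD-addL (map (x *_) ys) _ (suc i)) (cong (_+ _) (lookupD-scale x ys (suc i)))

∷-cong : ∀ {x y} xs ys → x ≡ y → xs ≐ ys → x ∷ xs ≐ y ∷ ys
∷-cong xs ys x≡y h zero    = x≡y
∷-cong xs ys x≡y h (suc i) = h i

drop1-cong : ∀ xs ys → xs ≐ ys → drop 1 xs ≐ drop 1 ys
drop1-cong xs ys h i = trans (lookupD-drop1 xs i) (trans (h (suc i)) (sym (lookupD-drop1 ys i)))

addL-cong : ∀ xs xs′ ys ys′ → xs ≐ xs′ → ys ≐ ys′ → addL xs ys ≐ addL xs′ ys′
addL-cong xs xs′ ys ys′ h h′ i = begin
  lookupD (addL xs ys) i        ≡⟨ lookupD-addL xs ys i ⟩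
  lookupD xs i + lookupD ys i   ≡⟨ cong₂ _+_ (h i) (h′ i) ⟩
  lookupD xs′ i + lookupD ys′ i ≡⟨ lookupD-addL xs′ ys′ i ⟨
  lookupD (addL xs′ ys′) i      ∎
  where open ≡-Reasoning

mulL-congˡ : ∀ xs xs′ ys → xs ≐ xs′ → mulL xs ys ≐ mulL xs′ ys
mulL-congˡ xs xs′ ys h zero = begin
  lookupD (mulL xs ys) 0        ≡⟨ lookupD-mulL-zero xs ys ⟩
  lookupD xs 0 * lookupD ys 0   ≡⟨ cong (_* lookupD ys 0) (h 0) ⟩
  lookupD xs′ 0 * lookupD ys 0  ≡⟨ lookupD-mulL-zero xs′ ys ⟨
  lookupD (mulL xs′ ys) 0       ∎
  where open ≡-Reasoning
mulL-congˡ xs xs′ ys h (suc i) = begin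
  lookupD (mulL xs ys) (suc i)
    ≡⟨ lookupD-mulL-suc xs ys i ⟩
  lookupD xs 0 * lookupD ys (suc i) + lookupD (mulL (drop 1 xs) ys) i
    ≡⟨ cong₂ _+_ (cong (_* lookupD ys (suc i)) (h 0))
                 (mulL-congˡ (drop 1 xs) (drop 1 xs′) ys (drop1-cong xs xs′ h) i) ⟩
  lookupD xs′ 0 * lookupD ys (suc i) + lookupD (mulL (drop 1 xs′) ys) i
    ≡⟨ lookupD-mulL-suc xs′ ys i ⟨
  lookupD (mulL xs′ ys) (suc i) ∎
  where open ≡-Reasoning

lookupD-mulL : ∀ xs ys i →
  lookupD (mulL xs ys) i ≡ lookupD xs 0 * lookupD ys i + lookupD (0 ∷ mulL (drop 1 xs) ys) i
lookupD-mulL xs ys zero    = trans (lookupD-mulL-zero xs ys) (sym (+-identityʳ _))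
lookupD-mulL xs ys (suc i) = lookupD-mulL-suc xs ys i

-- Expanding both factors once, (x₀ + q X)(y₀ + q Y) = x₀y₀ + q (x₀Y + y₀X) + q² XY is visibly symmetric.
mulL-comm : ∀ xs ys → mulL xs ys ≐ mulL ys xs
mulL-comm xs ys zero = begin
  lookupD (mulL xs ys) 0       ≡⟨ lookupD-mulL-zero xs ys ⟩
  lookupD xs 0 * lookupD ys 0  ≡⟨ *-comm (lookupD xs 0) _ ⟩
  lookupD ys 0 * lookupD xs 0  ≡⟨ lookupD-mulL-zero ys xs ⟨
  lookupD (mulL ys xs) 0       ∎
  where open ≡-Reasoning
mulL-comm xs ys (suc i) = begin
  lookupD (mulL xs ys) (suc i)  ≡⟨ expand xs ys ⟩
  a + (b + t ys xs)             ≡⟨ cong (λ z → a + (b + z)) (tails i) ⟩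
  a + (b + t xs ys)             ≡⟨ x∙yz≈y∙xz a b _ ⟩
  b + (a + t xs ys)             ≡⟨ expand ys xs ⟨
  lookupD (mulL ys xs) (suc i)  ∎
  where
  open ≡-Reasoning
  a b : ℕ
  a = lookupD xs 0 * lookupD ys (suc i)
  b = lookupD ys 0 * lookupD xs (suc i)
  t : List ℕ → List ℕ → ℕ
  t us vs = lookupD (0 ∷ mulL (drop 1 us) (drop 1 vs)) i
  tails : ∀ j → lookupD (0 ∷ mulL (drop 1 ys) (drop 1 xs)) j ≡ lookupD (0 ∷ mulL (drop 1 xs) (drop 1 ys)) j
  tails zero    = refl
  tails (suc j) = mulL-comm (drop 1 ys) (drop 1 xs) j
  expand : ∀ us vs → lookupD (mulL us vs) (suc i) ≡
    lookupD us 0 * lookupD vs (suc i) + (lookupD vs 0 * lookupD us (suc i) + t vs us)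
  expand us vs = begin
    lookupD (mulL us vs) (suc i)
      ≡⟨ lookupD-mulL-suc us vs i ⟩
    u₀v + lookupD (mulL (drop 1 us) vs) i
      ≡⟨ cong (u₀v +_) (mulL-comm (drop 1 us) vs i) ⟩
    u₀v + lookupD (mulL vs (drop 1 us)) i
      ≡⟨ cong (u₀v +_) (lookupD-mulL vs (drop 1 us) i) ⟩
    u₀v + (lookupD vs 0 * lookupD (drop 1 us) i + t vs us)
      ≡⟨ cong (λ z → u₀v + (lookupD vs 0 * z + t vs us)) (lookupD-drop1 us i) ⟩
    u₀v + (lookupD vs 0 * lookupD us (suc i) + t vs us) ∎
    where
    u₀v : ℕ
    u₀v = lookupD us 0 * lookupD vs (suc i)

lookupD-scale-∷0 : ∀ c xs i → lookupD (0 ∷ map (c *_) xs) i ≡ c * lookupD (0 ∷ xs) i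
lookupD-scale-∷0 c xs zero    = sym (*-zeroʳ c)
lookupD-scale-∷0 c xs (suc i) = lookupD-scale c xs i

mulL-shiftˡ : ∀ xs ys → mulL (0 ∷ xs) ys ≐ 0 ∷ mulL xs ys
mulL-shiftˡ xs ys i =
  trans (lookupD-addL (map (0 *_) ys) (0 ∷ mulL xs ys) i)
        (cong (_+ lookupD (0 ∷ mulL xs ys) i) (lookupD-scale 0 ys i))

mulL-scaleˡ : ∀ c xs ys → mulL (map (c *_) xs) ys ≐ map (c *_) (mulL xs ys)
mulL-scaleˡ c []       ys i = refl
mulL-scaleˡ c (x ∷ xs) ys i = begin
  lookupD (mulL (map (c *_) (x ∷ xs)) ys) i
    ≡⟨ lookupD-mulL (c * x ∷ map (c *_) xs) ys i ⟩
  c * x * lookupD ys i + lookupD (0 ∷ mulL (map (c *_) xs) ys) i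
    ≡⟨ cong (c * x * lookupD ys i +_)
            (∷-cong (mulL (map (c *_) xs) ys) (map (c *_) (mulL xs ys)) refl (mulL-scaleˡ c xs ys) i) ⟩
  c * x * lookupD ys i + lookupD (0 ∷ map (c *_) (mulL xs ys)) i
    ≡⟨ cong₂ _+_ (*-assoc c x _) (lookupD-scale-∷0 c (mulL xs ys) i) ⟩
  c * (x * lookupD ys i) + c * lookupD (0 ∷ mulL xs ys) i
    ≡⟨ *-distribˡ-+ c _ _ ⟨
  c * (x * lookupD ys i + lookupD (0 ∷ mulL xs ys) i)
    ≡⟨ cong (c *_) (lookupD-mulL (x ∷ xs) ys i) ⟨
  c * lookupD (mulL (x ∷ xs) ys) i
    ≡⟨ lookupD-scale c (mulL (x ∷ xs) ys) i ⟨
  lookupD (map (c *_) (mulL (x ∷ xs) ys)) i ∎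
  where open ≡-Reasoning

drop1-addL : ∀ xs ys → drop 1 (addL xs ys) ≐ addL (drop 1 xs) (drop 1 ys)
drop1-addL xs ys i = begin
  lookupD (drop 1 (addL xs ys)) i                 ≡⟨ lookupD-drop1 (addL xs ys) i ⟩
  lookupD (addL xs ys) (suc i)                    ≡⟨ lookupD-addL xs ys (suc i) ⟩
  lookupD xs (suc i) + lookupD ys (suc i)         ≡⟨ cong₂ _+_ (lookupD-drop1 xs i) (lookupD-drop1 ys i) ⟨
  lookupD (drop 1 xs) i + lookupD (drop 1 ys) i   ≡⟨ lookupD-addL (drop 1 xs) (drop 1 ys) i ⟨
  lookupD (addL (drop 1 xs) (drop 1 ys)) i        ∎
  where open ≡-Reasoning

mulL-distribʳ : ∀ xs xs′ ys → mulL (addL xs xs′) ys ≐ addL (mulL xs ys) (mulL xs′ ys)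
mulL-distribʳ xs xs′ ys zero = begin
  lookupD (mulL (addL xs xs′) ys) 0                   ≡⟨ lookupD-mulL-zero (addL xs xs′) ys ⟩
  lookupD (addL xs xs′) 0 * lookupD ys 0              ≡⟨ cong (_* lookupD ys 0) (lookupD-addL xs xs′ 0) ⟩
  (lookupD xs 0 + lookupD xs′ 0) * lookupD ys 0       ≡⟨ *-distribʳ-+ (lookupD ys 0) (lookupD xs 0) _ ⟩
  lookupD xs 0 * lookupD ys 0 + lookupD xs′ 0 * lookupD ys 0
    ≡⟨ cong₂ _+_ (lookupD-mulL-zero xs ys) (lookupD-mulL-zero xs′ ys) ⟨
  lookupD (mulL xs ys) 0 + lookupD (mulL xs′ ys) 0    ≡⟨ lookupD-addL (mulL xs ys) (mulL xs′ ys) 0 ⟨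
  lookupD (addL (mulL xs ys) (mulL xs′ ys)) 0         ∎
  where open ≡-Reasoning
mulL-distribʳ xs xs′ ys (suc i) = begin
  lookupD (mulL (addL xs xs′) ys) (suc i)
    ≡⟨ lookupD-mulL-suc (addL xs xs′) ys i ⟩
  lookupD (addL xs xs′) 0 * y + lookupD (mulL (drop 1 (addL xs xs′)) ys) i
    ≡⟨ cong₂ _+_ (cong (_* y) (lookupD-addL xs xs′ 0)) tail ⟩
  (a + a′) * y + (t + t′)
    ≡⟨ solve 5 (λ a a′ y t t′ → (a :+ a′) :* y :+ (t :+ t′) := (a :* y :+ t) :+ (a′ :* y :+ t′))
               refl a a′ y t t′ ⟩
  (a * y + t) + (a′ * y + t′)
    ≡⟨ cong₂ _+_ (lookupD-mulL-suc xs ys i) (lookupD-mulL-suc xs′ ys i) ⟨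
  lookupD (mulL xs ys) (suc i) + lookupD (mulL xs′ ys) (suc i)
    ≡⟨ lookupD-addL (mulL xs ys) (mulL xs′ ys) (suc i) ⟨
  lookupD (addL (mulL xs ys) (mulL xs′ ys)) (suc i) ∎
  where
  open ≡-Reasoning
  open +-*-Solver using (solve; _:+_; _:*_; _:=_)
  y a a′ t t′ : ℕ
  y  = lookupD ys (suc i)
  a  = lookupD xs 0
  a′ = lookupD xs′ 0
  t  = lookupD (mulL (drop 1 xs) ys) i
  t′ = lookupD (mulL (drop 1 xs′) ys) i
  tail : lookupD (mulL (drop 1 (addL xs xs′)) ys) i ≡ t + t′
  tail = begin
    lookupD (mulL (drop 1 (addL xs xs′)) ys) i
      ≡⟨ mulL-congˡ (drop 1 (addL xs xs′)) (addL (drop 1 xs) (drop 1 xs′)) ys (drop1-addL xs xs′) i ⟩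
    lookupD (mulL (addL (drop 1 xs) (drop 1 xs′)) ys) i
      ≡⟨ mulL-distribʳ (drop 1 xs) (drop 1 xs′) ys i ⟩
    lookupD (addL (mulL (drop 1 xs) ys) (mulL (drop 1 xs′) ys)) i
      ≡⟨ lookupD-addL (mulL (drop 1 xs) ys) (mulL (drop 1 xs′) ys) i ⟩
    t + t′ ∎

mulL-assoc : ∀ xs ys zs → mulL (mulL xs ys) zs ≐ mulL xs (mulL ys zs)
mulL-assoc []       ys zs i = refl
mulL-assoc (x ∷ xs) ys zs i = begin
  lookupD (mulL (addL (map (x *_) ys) (0 ∷ mulL xs ys)) zs) i
    ≡⟨ mulL-distribʳ (map (x *_) ys) (0 ∷ mulL xs ys) zs i ⟩
  lookupD (addL (mulL (map (x *_) ys) zs) (mulL (0 ∷ mulL xs ys) zs)) i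
    ≡⟨ addL-cong (mulL (map (x *_) ys) zs) (map (x *_) (mulL ys zs))
                 (mulL (0 ∷ mulL xs ys) zs) (0 ∷ mulL xs (mulL ys zs))
                 (mulL-scaleˡ x ys zs) shifted i ⟩
  lookupD (addL (map (x *_) (mulL ys zs)) (0 ∷ mulL xs (mulL ys zs))) i ∎
  where
  open ≡-Reasoning
  shifted : mulL (0 ∷ mulL xs ys) zs ≐ 0 ∷ mulL xs (mulL ys zs)
  shifted j = trans (mulL-shiftˡ (mulL xs ys) zs j)
                    (∷-cong (mulL (mulL xs ys) zs) (mulL xs (mulL ys zs)) refl (mulL-assoc xs ys zs) j)

mulL-identityˡ : ∀ xs → mulL (1 ∷ []) xs ≐ xs
mulL-identityˡ xs i = begin
  lookupD (mulL (1 ∷ []) xs) i         ≡⟨ lookupD-mulL (1 ∷ []) xs i ⟩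
  1 * lookupD xs i + lookupD (0 ∷ []) i ≡⟨ cong₂ _+_ (*-identityˡ _) (zeros i) ⟩
  lookupD xs i + 0                      ≡⟨ +-identityʳ _ ⟩
  lookupD xs i                          ∎
  where
  open ≡-Reasoning
  zeros : ∀ j → lookupD (0 ∷ []) j ≡ 0
  zeros zero    = refl
  zeros (suc j) = refl

lookupℤ : List ℕ → ℤ → ℕ
lookupℤ cs (ℤ.+ m)    = lookupD cs m
lookupℤ cs ℤ.-[1+ _ ] = 0

coeff-lp : ∀ s cs n → coeff (lp s cs) n ≡ lookupℤ cs (n ℤ.+ ℤ.+ s)
coeff-lp s cs n with n ℤ.+ ℤ.+ s
... | ℤ.+ m    = refl
... | ℤ.-[1+ _ ] = refl

coeff-at : ∀ s cs m → coeff (lp s cs) (m ℤ.⊖ s) ≡ lookupD cs m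
coeff-at s cs m = trans (coeff-lp s cs (m ℤ.⊖ s)) (cong (lookupℤ cs) exponent)
  where
  exponent : (m ℤ.⊖ s) ℤ.+ ℤ.+ s ≡ ℤ.+ m
  exponent = trans (ℤ.distribˡ-⊖-+-pos s m s) (trans (ℤ.⊖-≥ (m≤n+m s m)) (cong ℤ.+_ (m+n∸n≡m m s)))

lp-cong : ∀ s cs cs′ → cs ≐ cs′ → lp s cs ≈ lp s cs′
lp-cong s cs cs′ h n rewrite coeff-lp s cs n | coeff-lp s cs′ n with n ℤ.+ ℤ.+ s
... | ℤ.+ m      = h m
... | ℤ.-[1+ _ ] = refl

coeff-addL : ∀ s cs cs′ n → coeff (lp s (addL cs cs′)) n ≡ coeff (lp s cs) n + coeff (lp s cs′) n
coeff-addL s cs cs′ n rewrite coeff-lp s (addL cs cs′) n | coeff-lp s cs n | coeff-lp s cs′ n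
  with n ℤ.+ ℤ.+ s
... | ℤ.+ m      = lookupD-addL cs cs′ m
... | ℤ.-[1+ _ ] = refl

coeff-nil : ∀ s n → coeff (lp s []) n ≡ 0
coeff-nil s n rewrite coeff-lp s [] n with n ℤ.+ ℤ.+ s
... | ℤ.+ m      = refl
... | ℤ.-[1+ _ ] = refl

pad : ℕ → List ℕ → List ℕ
pad d cs = replicate d 0 ++ cs

lookupD-pad : ∀ d cs m → lookupD (pad d cs) (d + m) ≡ lookupD cs m
lookupD-pad zero    cs m = refl
lookupD-pad (suc d) cs m = lookupD-pad d cs m

lookupD-pad-< : ∀ d cs i → i < d → lookupD (pad d cs) i ≡ 0
lookupD-pad-< (suc d) cs zero    _       = refl
lookupD-pad-< (suc d) cs (suc i) (s≤s h) = lookupD-pad-< d cs i h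

lookupℤ-pad-neg : ∀ e cs d j → d ≤ e → lookupℤ (pad e cs) (d ℤ.⊖ suc j) ≡ 0
lookupℤ-pad-neg e cs zero    j       _ = refl
lookupℤ-pad-neg e cs (suc d) zero    h = lookupD-pad-< e cs d h
lookupℤ-pad-neg e cs (suc d) (suc j) h rewrite ℤ.[1+m]⊖[1+n]≡m⊖n d (suc j) =
  lookupℤ-pad-neg e cs d j (≤-trans (n≤1+n d) h)

lookupℤ-pad : ∀ d cs z → lookupℤ (pad d cs) (z ℤ.+ ℤ.+ d) ≡ lookupℤ cs z
lookupℤ-pad d cs (ℤ.+ m)    = trans (cong (lookupD (pad d cs)) (+-comm m d)) (lookupD-pad d cs m)
lookupℤ-pad d cs ℤ.-[1+ j ] = lookupℤ-pad-neg d cs d j ≤-refl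

coeff-pad : ∀ s d cs n → coeff (lp (s + d) (pad d cs)) n ≡ coeff (lp s cs) n
coeff-pad s d cs n = begin
  coeff (lp (s + d) (pad d cs)) n                 ≡⟨ coeff-lp (s + d) (pad d cs) n ⟩
  lookupℤ (pad d cs) (n ℤ.+ ℤ.+ (s + d))
    ≡⟨ cong (lookupℤ (pad d cs)) (ℤ.+-assoc n (ℤ.+ s) (ℤ.+ d)) ⟨
  lookupℤ (pad d cs) (n ℤ.+ ℤ.+ s ℤ.+ ℤ.+ d)      ≡⟨ lookupℤ-pad d cs (n ℤ.+ ℤ.+ s) ⟩
  lookupℤ cs (n ℤ.+ ℤ.+ s)                        ≡⟨ coeff-lp s cs n ⟨
  coeff (lp s cs) n                               ∎
  where open ≡-Reasoning

align : ℕ → LP → List ℕ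
align S (lp s cs) = pad (S ∸ s) cs

align-≈ : ∀ S p → LP.shift p ≤ S → lp S (align S p) ≈ p
align-≈ S (lp s cs) s≤S n =
  trans (cong (λ S′ → coeff (lp S′ (pad (S ∸ s) cs)) n) (sym (m+[n∸m]≡n s≤S))) (coeff-pad s (S ∸ s) cs n)

≈⇒align-≐ : ∀ S p p′ → p ≈ p′ → LP.shift p ≤ S → LP.shift p′ ≤ S → align S p ≐ align S p′
≈⇒align-≐ S p p′ p≈p′ p≤S p′≤S m = begin
  lookupD (align S p) m              ≡⟨ coeff-at S (align S p) m ⟨
  coeff (lp S (align S p)) (m ℤ.⊖ S)   ≡⟨ align-≈ S p p≤S (m ℤ.⊖ S) ⟩
  coeff p (m ℤ.⊖ S)                    ≡⟨ p≈p′ (m ℤ.⊖ S) ⟩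
  coeff p′ (m ℤ.⊖ S)                   ≡⟨ align-≈ S p′ p′≤S (m ℤ.⊖ S) ⟨
  coeff (lp S (align S p′)) (m ℤ.⊖ S)  ≡⟨ coeff-at S (align S p′) m ⟩
  lookupD (align S p′) m             ∎
  where open ≡-Reasoning

coeff-⊕ : ∀ p p′ n → coeff (p ⊕ p′) n ≡ coeff p n + coeff p′ n
coeff-⊕ p@(lp s _) p′@(lp s′ _) n =
  trans (coeff-addL (s ⊔ s′) (align (s ⊔ s′) p) (align (s ⊔ s′) p′) n)
        (cong₂ _+_ (align-≈ (s ⊔ s′) p (m≤m⊔n s s′) n) (align-≈ (s ⊔ s′) p′ (m≤n⊔m s s′) n))

mulL-pad : ∀ d cs cs′ → mulL (pad d cs) cs′ ≐ pad d (mulL cs cs′)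
mulL-pad zero    cs cs′ i       = refl
mulL-pad (suc d) cs cs′ zero    = mulL-shiftˡ (pad d cs) cs′ zero
mulL-pad (suc d) cs cs′ (suc i) = trans (mulL-shiftˡ (pad d cs) cs′ (suc i)) (mulL-pad d cs cs′ i)

align-⊛ : ∀ S p p′ → LP.shift p ≤ S → lp (S + LP.shift p′) (mulL (align S p) (LP.cs p′)) ≈ p ⊛ p′
align-⊛ S (lp s cs) (lp s′ cs′) s≤S n = begin
  coeff (lp (S + s′) (mulL (pad (S ∸ s) cs) cs′)) n
    ≡⟨ lp-cong (S + s′) _ _ (mulL-pad (S ∸ s) cs cs′) n ⟩
  coeff (lp (S + s′) (pad (S ∸ s) (mulL cs cs′))) n
    ≡⟨ cong (λ S′ → coeff (lp S′ (pad (S ∸ s) (mulL cs cs′))) n) shifts ⟩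
  coeff (lp (s + s′ + (S ∸ s)) (pad (S ∸ s) (mulL cs cs′))) n
    ≡⟨ coeff-pad (s + s′) (S ∸ s) (mulL cs cs′) n ⟩
  coeff (lp (s + s′) (mulL cs cs′)) n ∎
  where
  open ≡-Reasoning
  shifts : S + s′ ≡ s + s′ + (S ∸ s)
  shifts = begin
    S + s′               ≡⟨ cong (_+ s′) (m+[n∸m]≡n s≤S) ⟨
    s + (S ∸ s) + s′     ≡⟨ +-assoc s (S ∸ s) s′ ⟩
    s + ((S ∸ s) + s′)   ≡⟨ cong (s +_) (+-comm (S ∸ s) s′) ⟩
    s + (s′ + (S ∸ s))   ≡⟨ +-assoc s s′ (S ∸ s) ⟨
    s + s′ + (S ∸ s)     ∎

⊛-congˡ : ∀ p p₂ p′ → p ≈ p₂ → p ⊛ p′ ≈ p₂ ⊛ p′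
⊛-congˡ p@(lp s _) p₂@(lp s₂ _) p′@(lp s′ cs′) p≈p₂ n = begin
  coeff (p ⊛ p′) n                                     ≡⟨ align-⊛ S p p′ (m≤m⊔n s s₂) n ⟨
  coeff (lp (S + s′) (mulL (align S p) cs′)) n         ≡⟨ lp-cong (S + s′) _ _ aligned n ⟩
  coeff (lp (S + s′) (mulL (align S p₂) cs′)) n        ≡⟨ align-⊛ S p₂ p′ (m≤n⊔m s s₂) n ⟩
  coeff (p₂ ⊛ p′) n                                    ∎
  where
  open ≡-Reasoning
  S : ℕ
  S = s ⊔ s₂
  aligned : mulL (align S p) cs′ ≐ mulL (align S p₂) cs′
  aligned = mulL-congˡ (align S p) (align S p₂) cs′
                       (≈⇒align-≐ S p p₂ p≈p₂ (m≤m⊔n s s₂) (m≤n⊔m s s₂))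

⊛-comm : ∀ p p′ → p ⊛ p′ ≈ p′ ⊛ p
⊛-comm (lp s cs) (lp s′ cs′) n =
  trans (lp-cong (s + s′) _ _ (mulL-comm cs cs′) n) (cong (λ S → coeff (lp S (mulL cs′ cs)) n) (+-comm s s′))

⊛-assoc : ∀ p p′ p″ → (p ⊛ p′) ⊛ p″ ≈ p ⊛ (p′ ⊛ p″)
⊛-assoc (lp s cs) (lp s′ cs′) (lp s″ cs″) n =
  trans (lp-cong (s + s′ + s″) _ _ (mulL-assoc cs cs′ cs″) n)
        (cong (λ S → coeff (lp S (mulL cs (mulL cs′ cs″))) n) (+-assoc s s′ s″))

⊛-identityˡ : ∀ p → 𝟙 ⊛ p ≈ p
⊛-identityˡ (lp s cs) = lp-cong s _ _ (mulL-identityˡ cs)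

⊛-zeroˡ : ∀ p → 𝟘 ⊛ p ≈ 𝟘
⊛-zeroˡ (lp s cs) n = trans (coeff-nil s n) (sym (coeff-nil 0 n))

⊕-identityˡ : ∀ p → 𝟘 ⊕ p ≈ p
⊕-identityˡ p n = trans (coeff-⊕ 𝟘 p n) (cong (_+ coeff p n) (coeff-nil 0 n))

⊕-comm : ∀ p p′ → p ⊕ p′ ≈ p′ ⊕ p
⊕-comm p p′ n = trans (coeff-⊕ p p′ n) (trans (+-comm (coeff p n) _) (sym (coeff-⊕ p′ p n)))

⊕-assoc : ∀ p p′ p″ → (p ⊕ p′) ⊕ p″ ≈ p ⊕ (p′ ⊕ p″)
⊕-assoc p p′ p″ n = begin
  coeff ((p ⊕ p′) ⊕ p″) n                     ≡⟨ coeff-⊕ (p ⊕ p′) p″ n ⟩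
  coeff (p ⊕ p′) n + coeff p″ n               ≡⟨ cong (_+ coeff p″ n) (coeff-⊕ p p′ n) ⟩
  coeff p n + coeff p′ n + coeff p″ n         ≡⟨ +-assoc (coeff p n) _ _ ⟩
  coeff p n + (coeff p′ n + coeff p″ n)       ≡⟨ cong (coeff p n +_) (coeff-⊕ p′ p″ n) ⟨
  coeff p n + coeff (p′ ⊕ p″) n               ≡⟨ coeff-⊕ p (p′ ⊕ p″) n ⟨
  coeff (p ⊕ (p′ ⊕ p″)) n                     ∎
  where open ≡-Reasoning

⊕-cong : ∀ p p₂ p′ p₂′ → p ≈ p₂ → p′ ≈ p₂′ → p ⊕ p′ ≈ p₂ ⊕ p₂′
⊕-cong p p₂ p′ p₂′ h h′ n =
  trans (coeff-⊕ p p′ n) (trans (cong₂ _+_ (h n) (h′ n)) (sym (coeff-⊕ p₂ p₂′ n)))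

⊛-distribʳ : ∀ p p′ p″ → (p′ ⊕ p″) ⊛ p ≈ p′ ⊛ p ⊕ p″ ⊛ p
⊛-distribʳ p@(lp s cs) p′@(lp s′ _) p″@(lp s″ _) n = begin
  coeff (lp (S + s) (mulL (addL a b) cs)) n
    ≡⟨ lp-cong (S + s) _ _ (mulL-distribʳ a b cs) n ⟩
  coeff (lp (S + s) (addL (mulL a cs) (mulL b cs))) n
    ≡⟨ coeff-addL (S + s) (mulL a cs) (mulL b cs) n ⟩
  coeff (lp (S + s) (mulL a cs)) n + coeff (lp (S + s) (mulL b cs)) n
    ≡⟨ cong₂ _+_ (align-⊛ S p′ p (m≤m⊔n s′ s″) n) (align-⊛ S p″ p (m≤n⊔m s′ s″) n) ⟩
  coeff (p′ ⊛ p) n + coeff (p″ ⊛ p) n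
    ≡⟨ coeff-⊕ (p′ ⊛ p) (p″ ⊛ p) n ⟨
  coeff (p′ ⊛ p ⊕ p″ ⊛ p) n ∎
  where
  open ≡-Reasoning
  S : ℕ
  S = s′ ⊔ s″
  a b : List ℕ
  a = align S p′
  b = align S p″

infix 4 _≃_

-- p ≈ p′ unfolds to a Π-type from which Agda cannot recover p and p′; this wrapper can.
record _≃_ (p p′ : LP) : Set where
  constructor ≈⇒≃
  field ≃⇒≈ : p ≈ p′
open _≃_ public

≃-isEquivalence : IsEquivalence _≃_
≃-isEquivalence = record
  { refl  = ≈⇒≃ (λ n → refl)
  ; sym   = λ (≈⇒≃ h) → ≈⇒≃ (λ n → sym (h n))
  ; trans = λ (≈⇒≃ h) (≈⇒≃ h′) → ≈⇒≃ (λ n → trans (h n) (h′ n))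
  }

⊛-cong : ∀ {p p₂ p′ p₂′} → p ≃ p₂ → p′ ≃ p₂′ → p ⊛ p′ ≃ p₂ ⊛ p₂′
⊛-cong {p} {p₂} {p′} {p₂′} (≈⇒≃ h) (≈⇒≃ h′) = ≈⇒≃ λ n → begin
  coeff (p ⊛ p′) n    ≡⟨ ⊛-congˡ p p₂ p′ h n ⟩
  coeff (p₂ ⊛ p′) n   ≡⟨ ⊛-comm p₂ p′ n ⟩
  coeff (p′ ⊛ p₂) n   ≡⟨ ⊛-congˡ p′ p₂′ p₂ h′ n ⟩
  coeff (p₂′ ⊛ p₂) n  ≡⟨ ⊛-comm p₂′ p₂ n ⟩
  coeff (p₂ ⊛ p₂′) n  ∎
  where open ≡-Reasoning

LP-isCommutativeSemiring : IsCommutativeSemiring _≃_ _⊕_ _⊛_ 𝟘 𝟙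
LP-isCommutativeSemiring = isCommutativeSemiringˡ record
  { +-isCommutativeMonoid = record
    { isMonoid = record
      { isSemigroup = record
        { isMagma = record
          { isEquivalence = ≃-isEquivalence
          ; ∙-cong = λ {p} {p₂} {p′} {p₂′} (≈⇒≃ h) (≈⇒≃ h′) → ≈⇒≃ (⊕-cong p p₂ p′ p₂′ h h′) }
        ; assoc = λ p p′ p″ → ≈⇒≃ (⊕-assoc p p′ p″) }
      ; identity = (λ p → ≈⇒≃ (⊕-identityˡ p))
                 , (λ p → ≈⇒≃ (λ n → trans (⊕-comm p 𝟘 n) (⊕-identityˡ p n))) }
    ; comm = λ p p′ → ≈⇒≃ (⊕-comm p p′) }
  ; *-isCommutativeMonoid = record
    { isMonoid = record
      { isSemigroup = record
        { isMagma = record { isEquivalence = ≃-isEquivalence ; ∙-cong = ⊛-cong }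
        ; assoc = λ p p′ p″ → ≈⇒≃ (⊛-assoc p p′ p″) }
      ; identity = (λ p → ≈⇒≃ (⊛-identityˡ p))
                 , (λ p → ≈⇒≃ (λ n → trans (⊛-comm p 𝟙 n) (⊛-identityˡ p n))) }
    ; comm = λ p p′ → ≈⇒≃ (⊛-comm p p′) }
  ; distribʳ = λ p p′ p″ → ≈⇒≃ (⊛-distribʳ p p′ p″)
  ; zeroˡ = λ p → ≈⇒≃ (⊛-zeroˡ p)
  }

LP-commutativeSemiring : CommutativeSemiring 0ℓ 0ℓ
LP-commutativeSemiring = record { isCommutativeSemiring = LP-isCommutativeSemiring }

module ℒ = CommutativeSemiring LP-commutativeSemiring
module ≃-Reasoning = SetoidReasoning ℒ.setoid
module LP-Solver = Algebra.Solver.Ring.NaturalCoefficients.Default LP-commutativeSemiring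

open import Algebra.Properties.CommutativeSemigroup ℒ.+-commutativeSemigroup
  using () renaming (interchange to ⊕-interchange)

infix 4 _≐ᵇ_ _≃ᵇ_

_≐ᵇ_ : List ℕ → List ℕ → Bool
[]       ≐ᵇ []       = true
[]       ≐ᵇ (y ∷ ys) = (y ≡ᵇ 0) ∧ ([] ≐ᵇ ys)
(x ∷ xs) ≐ᵇ []       = (x ≡ᵇ 0) ∧ (xs ≐ᵇ [])
(x ∷ xs) ≐ᵇ (y ∷ ys) = (x ≡ᵇ y) ∧ (xs ≐ᵇ ys)

≐ᵇ⇒≐ : ∀ xs ys → T (xs ≐ᵇ ys) → xs ≐ ys
≐ᵇ⇒≐ []       []       _ i       = refl
≐ᵇ⇒≐ []       (y ∷ ys) h zero    = sym (≡ᵇ⇒≡ y 0 (proj₁ (Equivalence.to T-∧ h)))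
≐ᵇ⇒≐ []       (y ∷ ys) h (suc i) = ≐ᵇ⇒≐ [] ys (proj₂ (Equivalence.to (T-∧ {y ≡ᵇ 0}) h)) i
≐ᵇ⇒≐ (x ∷ xs) []       h zero    = ≡ᵇ⇒≡ x 0 (proj₁ (Equivalence.to T-∧ h))
≐ᵇ⇒≐ (x ∷ xs) []       h (suc i) = ≐ᵇ⇒≐ xs [] (proj₂ (Equivalence.to (T-∧ {x ≡ᵇ 0}) h)) i
≐ᵇ⇒≐ (x ∷ xs) (y ∷ ys) h zero    = ≡ᵇ⇒≡ x y (proj₁ (Equivalence.to T-∧ h))
≐ᵇ⇒≐ (x ∷ xs) (y ∷ ys) h (suc i) = ≐ᵇ⇒≐ xs ys (proj₂ (Equivalence.to (T-∧ {x ≡ᵇ y}) h)) i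

-- Identities between concrete Laurent polynomials below are checked by evaluating this test.
_≃ᵇ_ : LP → LP → Bool
p@(lp s _) ≃ᵇ p′@(lp s′ _) = align (s ⊔ s′) p ≐ᵇ align (s ⊔ s′) p′

≃ᵇ⇒≃ : ∀ p p′ → T (p ≃ᵇ p′) → p ≃ p′
≃ᵇ⇒≃ p@(lp s _) p′@(lp s′ _) h = ≈⇒≃ λ n → begin
  coeff p n                    ≡⟨ align-≈ S p (m≤m⊔n s s′) n ⟨
  coeff (lp S (align S p)) n   ≡⟨ lp-cong S _ _ (≐ᵇ⇒≐ (align S p) (align S p′) h) n ⟩
  coeff (lp S (align S p′)) n  ≡⟨ align-≈ S p′ (m≤n⊔m s s′) n ⟩
  coeff p′ n                   ∎
  where
  open ≡-Reasoning
  S : ℕ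
  S = s ⊔ s′

-- 2×2 matrices and column vectors

infix 4 _≃ᴹ_ _≃ⱽ_

record _≃ᴹ_ (M N : M2) : Set where
  constructor mk≃ᴹ
  field
    m11≃ : M2.m11 M ≃ M2.m11 N
    m12≃ : M2.m12 M ≃ M2.m12 N
    m21≃ : M2.m21 M ≃ M2.m21 N
    m22≃ : M2.m22 M ≃ M2.m22 N
open _≃ᴹ_ public

≃ᴹ-refl : ∀ {M} → M ≃ᴹ M
≃ᴹ-refl = mk≃ᴹ ℒ.refl ℒ.refl ℒ.refl ℒ.refl

≃ᴹ-sym : ∀ {M N} → M ≃ᴹ N → N ≃ᴹ M
≃ᴹ-sym (mk≃ᴹ a b c d) = mk≃ᴹ (ℒ.sym a) (ℒ.sym b) (ℒ.sym c) (ℒ.sym d)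

≃ᴹ-trans : ∀ {M N P} → M ≃ᴹ N → N ≃ᴹ P → M ≃ᴹ P
≃ᴹ-trans (mk≃ᴹ a b c d) (mk≃ᴹ a′ b′ c′ d′) =
  mk≃ᴹ (ℒ.trans a a′) (ℒ.trans b b′) (ℒ.trans c c′) (ℒ.trans d d′)

≃ᴹ-reflexive : ∀ {M N} → M ≡ N → M ≃ᴹ N
≃ᴹ-reflexive refl = ≃ᴹ-refl

≋⇒≃ᴹ : ∀ {M N} → M ≋ N → M ≃ᴹ N
≋⇒≃ᴹ {mat _ _ _ _} {mat _ _ _ _} (a , b , c , d) = mk≃ᴹ (≈⇒≃ a) (≈⇒≃ b) (≈⇒≃ c) (≈⇒≃ d)

⊗-cong : ∀ {M M′ N N′} → M ≃ᴹ M′ → N ≃ᴹ N′ → M ⊗ N ≃ᴹ M′ ⊗ N′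
⊗-cong {mat _ _ _ _} {mat _ _ _ _} {mat _ _ _ _} {mat _ _ _ _} (mk≃ᴹ a b c d) (mk≃ᴹ a′ b′ c′ d′) =
  mk≃ᴹ (ℒ.+-cong (ℒ.*-cong a a′) (ℒ.*-cong b c′)) (ℒ.+-cong (ℒ.*-cong a b′) (ℒ.*-cong b d′))
       (ℒ.+-cong (ℒ.*-cong c a′) (ℒ.*-cong d c′)) (ℒ.+-cong (ℒ.*-cong c b′) (ℒ.*-cong d d′))

record V2 : Set where
  constructor vec
  field top bottom : LP

record _≃ⱽ_ (u v : V2) : Set where
  constructor mk≃ⱽ
  field
    top≃    : V2.top u ≃ V2.top v
    bottom≃ : V2.bottom u ≃ V2.bottom v
open _≃ⱽ_ public

≃ⱽ-refl : ∀ {u} → u ≃ⱽ u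
≃ⱽ-refl = mk≃ⱽ ℒ.refl ℒ.refl

≃ⱽ-sym : ∀ {u v} → u ≃ⱽ v → v ≃ⱽ u
≃ⱽ-sym (mk≃ⱽ a b) = mk≃ⱽ (ℒ.sym a) (ℒ.sym b)

≃ⱽ-trans : ∀ {u v w} → u ≃ⱽ v → v ≃ⱽ w → u ≃ⱽ w
≃ⱽ-trans (mk≃ⱽ a b) (mk≃ⱽ a′ b′) = mk≃ⱽ (ℒ.trans a a′) (ℒ.trans b b′)

≃ⱽ-setoid : Setoid 0ℓ 0ℓ
≃ⱽ-setoid = record
  { Carrier = V2 ; _≈_ = _≃ⱽ_
  ; isEquivalence = record { refl = ≃ⱽ-refl ; sym = ≃ⱽ-sym ; trans = ≃ⱽ-trans } }

module ≃ⱽ-Reasoning = SetoidReasoning ≃ⱽ-setoid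

infixr 6 _·_

_·_ : M2 → V2 → V2
mat a b c d · vec x y = vec (a ⊛ x ⊕ b ⊛ y) (c ⊛ x ⊕ d ⊛ y)

rightColumn : M2 → V2
rightColumn (mat a b c d) = vec b d

·-cong : ∀ {M M′ u v} → M ≃ᴹ M′ → u ≃ⱽ v → M · u ≃ⱽ M′ · v
·-cong {mat _ _ _ _} {mat _ _ _ _} (mk≃ᴹ a b c d) (mk≃ⱽ x y) =
  mk≃ⱽ (ℒ.+-cong (ℒ.*-cong a x) (ℒ.*-cong b y)) (ℒ.+-cong (ℒ.*-cong c x) (ℒ.*-cong d y))

⊗-· : ∀ M N v → (M ⊗ N) · v ≃ⱽ M · N · v
⊗-· (mat a b c d) (mat a′ b′ c′ d′) (vec x y) = mk≃ⱽ (entry a b) (entry c d)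
  where
  open LP-Solver
  entry : ∀ u v → (u ⊛ a′ ⊕ v ⊛ c′) ⊛ x ⊕ (u ⊛ b′ ⊕ v ⊛ d′) ⊛ y
                ≃ u ⊛ (a′ ⊛ x ⊕ b′ ⊛ y) ⊕ v ⊛ (c′ ⊛ x ⊕ d′ ⊛ y)
  entry u v = solve 8 (λ u v a′ b′ c′ d′ x y →
    (u :* a′ :+ v :* c′) :* x :+ (u :* b′ :+ v :* d′) :* y
      := u :* (a′ :* x :+ b′ :* y) :+ v :* (c′ :* x :+ d′ :* y)) ℒ.refl u v a′ b′ c′ d′ x y

⊗-assoc : ∀ M N P → (M ⊗ N) ⊗ P ≃ᴹ M ⊗ (N ⊗ P)
⊗-assoc M@(mat _ _ _ _) N@(mat _ _ _ _) (mat a b c d) =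
  mk≃ᴹ (top≃ (⊗-· M N (vec a c))) (top≃ (⊗-· M N (vec b d)))
       (bottom≃ (⊗-· M N (vec a c))) (bottom≃ (⊗-· M N (vec b d)))

I₂ : M2
I₂ = mat 𝟙 𝟘 𝟘 𝟙

⊗-identityˡ : ∀ M → I₂ ⊗ M ≃ᴹ M
⊗-identityˡ (mat a b c d) = mk≃ᴹ (top a c) (top b d) (bottom a c) (bottom b d)
  where
  open LP-Solver
  top : ∀ x y → 𝟙 ⊛ x ⊕ 𝟘 ⊛ y ≃ x
  top = solve 2 (λ x y → con 1 :* x :+ con 0 :* y := x) ℒ.refl
  bottom : ∀ x y → 𝟘 ⊛ x ⊕ 𝟙 ⊛ y ≃ y
  bottom = solve 2 (λ x y → con 0 :* x :+ con 1 :* y := y) ℒ.refl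

⊗-identityʳ : ∀ M → M ⊗ I₂ ≃ᴹ M
⊗-identityʳ (mat a b c d) = mk≃ᴹ (left a b) (right a b) (left c d) (right c d)
  where
  open LP-Solver
  left : ∀ x y → x ⊛ 𝟙 ⊕ y ⊛ 𝟘 ≃ x
  left = solve 2 (λ x y → x :* con 1 :+ y :* con 0 := x) ℒ.refl
  right : ∀ x y → x ⊛ 𝟘 ⊕ y ⊛ 𝟙 ≃ y
  right = solve 2 (λ x y → x :* con 0 :+ y :* con 1 := y) ℒ.refl

letterMatrix : AB → M2
letterMatrix A = A1
letterMatrix B = B1

wordMatrix : List AB → M2
wordMatrix []       = I₂
wordMatrix (w ∷ ws) = letterMatrix w ⊗ wordMatrix ws

wordMatrix-++ : ∀ u v → wordMatrix (u ++ v) ≃ᴹ wordMatrix u ⊗ wordMatrix v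
wordMatrix-++ []      v = ≃ᴹ-sym (⊗-identityˡ (wordMatrix v))
wordMatrix-++ (w ∷ u) v =
  ≃ᴹ-trans (⊗-cong (≃ᴹ-refl {letterMatrix w}) (wordMatrix-++ u v))
           (≃ᴹ-sym (⊗-assoc (letterMatrix w) (wordMatrix u) (wordMatrix v)))

transpose : M2 → M2
transpose (mat a b c d) = mat a c b d

-- Sums, and weighted counts of edge sets with prescribed degrees

∑ : ∀ {A : Set} → List A → (A → LP) → LP
∑ xs f = foldr (λ x acc → f x ⊕ acc) 𝟘 xs

infix 5 ∑
syntax ∑ xs (λ x → e) = ∑[ x ← xs ] e

when : Bool → LP → LP
when b p = if b then p else 𝟘

when-⊛ʳ : ∀ b p c → when b (p ⊛ c) ≃ when b p ⊛ c
when-⊛ʳ true  p c = ℒ.refl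
when-⊛ʳ false p c = ℒ.sym (ℒ.zeroˡ c)

when-cong : ∀ b {p p′} → p ≃ p′ → when b p ≃ when b p′
when-cong true  p≃p′ = p≃p′
when-cong false p≃p′ = ℒ.refl

when-⇔ : ∀ {P Q : Set} (P? : Dec P) (Q? : Dec Q) {p p′} →
         P ⇔ Q → p ≃ p′ → when (does P?) p ≃ when (does Q?) p′
when-⇔ P? Q? P⇔Q p≃p′ rewrite does-⇔ P⇔Q P? Q? = when-cong (does Q?) p≃p′

module _ {A : Set} where

  ∑-cong : ∀ (xs : List A) {f g} → (∀ {x} → x ∈ xs → f x ≃ g x) → ∑ xs f ≃ ∑ xs g
  ∑-cong []       f≃g = ℒ.refl
  ∑-cong (x ∷ xs) f≃g = ℒ.+-cong (f≃g (here refl)) (∑-cong xs (f≃g ∘ there))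

  ∑-++ : ∀ (xs ys : List A) f → ∑ (xs ++ ys) f ≃ ∑ xs f ⊕ ∑ ys f
  ∑-++ []       ys f = ℒ.sym (ℒ.+-identityˡ (∑ ys f))
  ∑-++ (x ∷ xs) ys f = ℒ.trans (ℒ.+-congˡ (∑-++ xs ys f)) (ℒ.sym (ℒ.+-assoc (f x) _ _))

  ∑-map : ∀ {B : Set} (h : B → A) xs f → ∑ (map h xs) f ≡ ∑ xs (f ∘ h)
  ∑-map h []       f = refl
  ∑-map h (x ∷ xs) f = cong (f (h x) ⊕_) (∑-map h xs f)

  ∑-scaleˡ : ∀ c (xs : List A) f → ∑[ x ← xs ] c ⊛ f x ≃ c ⊛ ∑ xs f
  ∑-scaleˡ c []       f = ℒ.sym (ℒ.zeroʳ c)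
  ∑-scaleˡ c (x ∷ xs) f = ℒ.trans (ℒ.+-congˡ (∑-scaleˡ c xs f)) (ℒ.sym (ℒ.distribˡ c (f x) _))

  ∑-scaleʳ : ∀ c (xs : List A) f → ∑[ x ← xs ] f x ⊛ c ≃ ∑ xs f ⊛ c
  ∑-scaleʳ c []       f = ℒ.sym (ℒ.zeroˡ c)
  ∑-scaleʳ c (x ∷ xs) f = ℒ.trans (ℒ.+-congˡ (∑-scaleʳ c xs f)) (ℒ.sym (ℒ.distribʳ c (f x) _))

  ∑-zero : ∀ (xs : List A) → ∑[ x ← xs ] 𝟘 ≃ 𝟘
  ∑-zero []       = ℒ.refl
  ∑-zero (x ∷ xs) = ℒ.trans (ℒ.+-identityˡ _) (∑-zero xs)

  ∑-when : ∀ b c (xs : List A) f → ∑[ x ← xs ] when b (c ⊛ f x) ≃ when b (c ⊛ ∑ xs f)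
  ∑-when true  c xs f = ∑-scaleˡ c xs f
  ∑-when false c xs f = ∑-zero xs

  ∑-filter : ∀ {P : A → Set} (P? : ∀ x → Dec (P x)) xs f →
    foldr _⊕_ 𝟘 (map f (filter P? xs)) ≃ ∑[ x ← xs ] when (does (P? x)) (f x)
  ∑-filter P? []       f = ℒ.refl
  ∑-filter P? (x ∷ xs) f with does (P? x)
  ... | true  = ℒ.+-congˡ (∑-filter P? xs f)
  ... | false = ℒ.trans (∑-filter P? xs f) (ℒ.sym (ℒ.+-identityˡ _))

  ∑-⊕ : ∀ (xs : List A) f g → ∑[ x ← xs ] f x ⊕ g x ≃ ∑ xs f ⊕ ∑ xs g
  ∑-⊕ []       f g = ℒ.sym (ℒ.+-identityˡ 𝟘)
  ∑-⊕ (x ∷ xs) f g = ℒ.trans (ℒ.+-congˡ (∑-⊕ xs f g)) (⊕-interchange (f x) (g x) (∑ xs f) (∑ xs g))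

  ∑-split : ∀ (xs : List A) (k : A → Bool) (f : A → Bool → LP) →
    ∑[ x ← xs ] f x (k x)
      ≃ (∑[ x ← xs ] when (k x) (f x true)) ⊕ (∑[ x ← xs ] when (not (k x)) (f x false))
  ∑-split xs k f = ℒ.trans (∑-cong xs (λ {x} _ → split (k x) (f x))) (∑-⊕ xs _ _)
    where
    split : ∀ b (g : Bool → LP) → g b ≃ when b (g true) ⊕ when (not b) (g false)
    split true  g = ℒ.sym (ℒ.+-identityʳ (g true))
    split false g = ℒ.sym (ℒ.+-identityˡ (g false))

select : Bool → Bool → Bool
select b k = if b then k else not k

bucket : ∀ {A : Set} → List A → (A → LP) → (A → Bool) → (A → Bool) → Bool → Bool → LP
bucket xs w k₁ k₂ b₁ b₂ = ∑[ x ← xs ] when (select b₂ (k₂ x)) (when (select b₁ (k₁ x)) (w x))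

∑-split₂ : ∀ {A : Set} (xs : List A) w k₁ k₂ (G : Bool → Bool → LP) →
  ∑[ x ← xs ] w x ⊛ G (k₁ x) (k₂ x)
    ≃ (bucket xs w k₁ k₂ true true ⊛ G true true ⊕ bucket xs w k₁ k₂ true false ⊛ G true false)
      ⊕ (bucket xs w k₁ k₂ false true ⊛ G false true ⊕ bucket xs w k₁ k₂ false false ⊛ G false false)
∑-split₂ xs w k₁ k₂ G =
  ℒ.trans (∑-split xs k₁ (λ x b₁ → w x ⊛ G b₁ (k₂ x))) (ℒ.+-cong (half true) (half false))
  where
  pull : ∀ b₁ b₂ → ∑[ x ← xs ] when (select b₂ (k₂ x)) (when (select b₁ (k₁ x)) (w x ⊛ G b₁ b₂))
                   ≃ bucket xs w k₁ k₂ b₁ b₂ ⊛ G b₁ b₂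
  pull b₁ b₂ = ℒ.trans (∑-cong xs (λ {x} _ → pull-point x)) (∑-scaleʳ (G b₁ b₂) xs _)
    where
    pull-point : ∀ x → when (select b₂ (k₂ x)) (when (select b₁ (k₁ x)) (w x ⊛ G b₁ b₂))
                       ≃ when (select b₂ (k₂ x)) (when (select b₁ (k₁ x)) (w x)) ⊛ G b₁ b₂
    pull-point x = ℒ.trans (when-cong (select b₂ (k₂ x)) (when-⊛ʳ (select b₁ (k₁ x)) (w x) (G b₁ b₂)))
                           (when-⊛ʳ (select b₂ (k₂ x)) _ (G b₁ b₂))
  half : ∀ b₁ → ∑[ x ← xs ] when (select b₁ (k₁ x)) (w x ⊛ G b₁ (k₂ x))
                ≃ bucket xs w k₁ k₂ b₁ true ⊛ G b₁ true ⊕ bucket xs w k₁ k₂ b₁ false ⊛ G b₁ false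
  half b₁ = ℒ.trans (∑-split xs k₂ (λ x b₂ → when (select b₁ (k₁ x)) (w x ⊛ G b₁ b₂)))
                    (ℒ.+-cong (pull b₁ true) (pull b₁ false))

==ᵥ⇒≡ : ∀ p p′ → T (p ==ᵥ p′) → p ≡ p′
==ᵥ⇒≡ (a , b) (c , d) h with Equivalence.to T-∧ h
... | a≡c , b≡d = cong₂ _,_ (≡ᵇ⇒≡ a c a≡c) (≡ᵇ⇒≡ b d b≡d)

incident⇒∈vertices : ∀ {E e p} → e ∈ E → T (incident p e) → p ∈ vertices E
incident⇒∈vertices {edge u v _ ∷ _} {p = p} (here refl) h with Equivalence.to (T-∨ {p ==ᵥ u}) h
... | inj₁ p=u = here (==ᵥ⇒≡ p u p=u)
... | inj₂ p=v = there (here (==ᵥ⇒≡ p v p=v))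
incident⇒∈vertices {edge _ _ _ ∷ _} (there e∈E) h = there (there (incident⇒∈vertices e∈E h))

vertices-++ : ∀ E E′ → vertices (E ++ E′) ≡ vertices E ++ vertices E′
vertices-++ []               E′ = refl
vertices-++ (edge u v _ ∷ E) E′ = cong (λ vs → u ∷ v ∷ vs) (vertices-++ E E′)

degreeIn-++ : ∀ S S′ p → degreeIn (S ++ S′) p ≡ degreeIn S p + degreeIn S′ p
degreeIn-++ S S′ p = trans (cong length (filter-++ incident? S S′)) (length-++ (filter incident? S))
  where
  incident? : (e : Edge) → Dec (incident p e ≡ true)
  incident? e = incident p e B.≟ true

degreeIn-outside : ∀ {S E p} → S ⊆ E → p ∉ vertices E → degreeIn S p ≡ 0
degreeIn-outside {S} {E} {p} S⊆E p∉E =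
  cong length (filter-none (λ e → incident p e B.≟ true) {S} (All.tabulate notIncident))
  where
  notIncident : ∀ {e} → e ∈ S → incident p e ≢ true
  notIncident e∈S incident≡true = p∉E (incident⇒∈vertices (S⊆E e∈S) (Equivalence.from T-≡ incident≡true))

∈-subsets⇒⊆ : ∀ {S} E → S ∈ subsets E → S ⊆ E
∈-subsets⇒⊆ []      (here refl) ()
∈-subsets⇒⊆ (e ∷ E) S∈ with ∈-++⁻ (map (e ∷_) (subsets E)) S∈
... | inj₂ S∈E = there ∘ ∈-subsets⇒⊆ E S∈E
... | inj₁ S∈eE with ∈-map⁻ (e ∷_) S∈eE
...   | S′ , S′∈E , refl = λ { (here refl) → here refl
                             ; (there x∈S′) → there (∈-subsets⇒⊆ E S′∈E x∈S′) }

∑-subsets-++ : ∀ P Q f →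
  ∑ (subsets (P ++ Q)) f ≃ ∑[ S₁ ← subsets P ] ∑[ S₂ ← subsets Q ] f (S₁ ++ S₂)
∑-subsets-++ []      Q f = ℒ.sym (ℒ.+-identityʳ (∑ (subsets Q) f))
∑-subsets-++ (e ∷ P) Q f = begin
  ∑ (map (e ∷_) (subsets (P ++ Q)) ++ subsets (P ++ Q)) f
    ≈⟨ ∑-++ (map (e ∷_) (subsets (P ++ Q))) (subsets (P ++ Q)) f ⟩
  ∑ (map (e ∷_) (subsets (P ++ Q))) f ⊕ ∑ (subsets (P ++ Q)) f
    ≡⟨ cong (_⊕ ∑ (subsets (P ++ Q)) f) (∑-map (e ∷_) (subsets (P ++ Q)) f) ⟩
  ∑ (subsets (P ++ Q)) (f ∘ (e ∷_)) ⊕ ∑ (subsets (P ++ Q)) f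
    ≈⟨ ℒ.+-cong (∑-subsets-++ P Q (f ∘ (e ∷_))) (∑-subsets-++ P Q f) ⟩
  ∑ (subsets P) (g ∘ (e ∷_)) ⊕ ∑ (subsets P) g
    ≡⟨ cong (_⊕ ∑ (subsets P) g) (∑-map (e ∷_) (subsets P) g) ⟨
  ∑ (map (e ∷_) (subsets P)) g ⊕ ∑ (subsets P) g
    ≈⟨ ∑-++ (map (e ∷_) (subsets P)) (subsets P) g ⟨
  ∑ (map (e ∷_) (subsets P) ++ subsets P) g ∎
  where
  open ≃-Reasoning
  g : List Edge → LP
  g S₁ = ∑[ S₂ ← subsets Q ] f (S₁ ++ S₂)

weight-++ : ∀ S S′ → weight (S ++ S′) ≃ weight S ⊛ weight S′
weight-++ []      S′ = ℒ.sym (ℒ.*-identityˡ (weight S′))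
weight-++ (e ∷ S) S′ =
  ℒ.trans (ℒ.*-congˡ {Edge.wt e} (weight-++ S S′)) (ℒ.sym (ℒ.*-assoc (Edge.wt e) (weight S) (weight S′)))

IsFactor : List Edge → (Vertex → ℕ) → List Edge → Set
IsFactor E τ S = All (λ p → degreeIn S p ≡ τ p) (vertices E)

isFactor? : ∀ E τ S → Dec (IsFactor E τ S)
isFactor? E τ S = all? (λ p → degreeIn S p ≟ τ p) (vertices E)

-- With τ = 1 these edge sets are the perfect matchings: factorSum E (λ _ → 1) unfolds to matchingSum E.
factorSum : List Edge → (Vertex → ℕ) → LP
factorSum E τ = foldr _⊕_ 𝟘 (map weight (filter (isFactor? E τ) (subsets E)))

factorSum-∑ : ∀ E τ → factorSum E τ ≃ ∑[ S ← subsets E ] when (does (isFactor? E τ S)) (weight S)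
factorSum-∑ E τ = ∑-filter (isFactor? E τ) (subsets E) weight

_≟ᵥ_ : (p p′ : Vertex) → Dec (p ≡ p′)
_≟ᵥ_ = ≡-dec _≟_ _≟_

open import Data.List.Membership.DecPropositional _≟ᵥ_ using (_∈?_)

Fits : List Vertex → (Vertex → ℕ) → List Edge → List Edge → Set
Fits I τ P S = All (λ p → p ∈ I ⊎ degreeIn S p ≡ τ p) (vertices P) × All (λ p → degreeIn S p ≤ τ p) I

fits? : ∀ I τ P S → Dec (Fits I τ P S)
fits? I τ P S = all? (λ p → (p ∈? I) ⊎-dec (degreeIn S p ≟ τ p)) (vertices P)
         ×-dec all? (λ p → degreeIn S p ≤? τ p) I

residual : (Vertex → ℕ) → List Edge → Vertex → ℕ
residual τ S p = τ p ∸ degreeIn S p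

module _ {P Q : List Edge} {I : List Vertex} {τ : Vertex → ℕ}
         (shared⊆I : ∀ {p} → p ∈ vertices P → p ∈ vertices Q → p ∈ I)
         (I⊆Q : ∀ {p} → p ∈ I → p ∈ vertices Q)
         {S₁ S₂ : List Edge} (S₁⊆P : S₁ ⊆ P) (S₂⊆Q : S₂ ⊆ Q) where

  private
    d₁ d₂ : Vertex → ℕ
    d₁ = degreeIn S₁
    d₂ = degreeIn S₂

    Balanced : Vertex → Set
    Balanced p = d₁ p + d₂ p ≡ τ p

    balanced⇔ : IsFactor (P ++ Q) τ (S₁ ++ S₂) ⇔ All Balanced (vertices P ++ vertices Q)
    balanced⇔ rewrite vertices-++ P Q = mk⇔
      (All.map (λ {p} h → trans (sym (degreeIn-++ S₁ S₂ p)) h))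
      (All.map (λ {p} h → trans (degreeIn-++ S₁ S₂ p) h))

  isFactor-++⇔ : IsFactor (P ++ Q) τ (S₁ ++ S₂) ⇔ (Fits I τ P S₁ × IsFactor Q (residual τ S₁) S₂)
  isFactor-++⇔ = mk⇔ (to ∘ Equivalence.to balanced⇔) (Equivalence.from balanced⇔ ∘ from)
    where
    to : All Balanced (vertices P ++ vertices Q) → Fits I τ P S₁ × IsFactor Q (residual τ S₁) S₂
    to bal = (All.tabulate onP , All.tabulate (d₁≤τ ∘ balQ ∘ I⊆Q)) , All.tabulate (d₂≡τ∸d₁ ∘ balQ)
      where
      balQ : ∀ {p} → p ∈ vertices Q → Balanced p
      balQ = All.lookup (proj₂ (All.++⁻ (vertices P) bal))
      d₁≤τ : ∀ {p} → Balanced p → d₁ p ≤ τ p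
      d₁≤τ {p} h = subst (d₁ p ≤_) h (m≤m+n (d₁ p) (d₂ p))
      d₂≡τ∸d₁ : ∀ {p} → Balanced p → d₂ p ≡ τ p ∸ d₁ p
      d₂≡τ∸d₁ {p} h = trans (sym (m+n∸m≡n (d₁ p) (d₂ p))) (cong (_∸ d₁ p) h)
      onP : ∀ {p} → p ∈ vertices P → p ∈ I ⊎ d₁ p ≡ τ p
      onP {p} p∈P with p ∈? I
      ... | yes p∈I = inj₁ p∈I
      ... | no  p∉I = inj₂ (begin
        d₁ p         ≡⟨ +-identityʳ (d₁ p) ⟨
        d₁ p + 0     ≡⟨ cong (d₁ p +_) (degreeIn-outside S₂⊆Q (p∉I ∘ shared⊆I p∈P)) ⟨
        d₁ p + d₂ p  ≡⟨ All.lookup (proj₁ (All.++⁻ (vertices P) bal)) p∈P ⟩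
        τ p          ∎)
        where open ≡-Reasoning
    from : Fits I τ P S₁ × IsFactor Q (residual τ S₁) S₂ → All Balanced (vertices P ++ vertices Q)
    from ((onP , onI) , onQ) = All.tabulate balanced
      where
      balQ : ∀ {p} → p ∈ vertices Q → Balanced p
      balQ {p} p∈Q = trans (cong (d₁ p +_) (All.lookup onQ p∈Q)) (m+[n∸m]≡n d₁≤τ)
        where
        d₁≤τ : d₁ p ≤ τ p
        d₁≤τ with p ∈? I
        ... | yes p∈I = All.lookup onI p∈I
        ... | no  p∉I = subst (_≤ τ p) (sym (degreeIn-outside S₁⊆P (p∉I ∘ flip shared⊆I p∈Q))) z≤n
      balanced : ∀ {p} → p ∈ vertices P ++ vertices Q → Balanced p
      balanced {p} p∈ with ∈-++⁻ (vertices P) p∈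
      ... | inj₂ p∈Q = balQ p∈Q
      ... | inj₁ p∈P with All.lookup onP p∈P | p ∈? vertices Q
      ...   | _            | yes p∈Q = balQ p∈Q
      ...   | inj₁ p∈I     | no  p∉Q = contradiction (I⊆Q p∈I) p∉Q
      ...   | inj₂ d₁≡τ    | no  p∉Q =
        trans (cong (d₁ p +_) (degreeIn-outside S₂⊆Q p∉Q)) (trans (+-identityʳ (d₁ p)) d₁≡τ)

factorSum-++ : ∀ P Q I τ →
  (∀ {p} → p ∈ vertices P → p ∈ vertices Q → p ∈ I) → (∀ {p} → p ∈ I → p ∈ vertices Q) →
  factorSum (P ++ Q) τ
    ≃ ∑[ S ← subsets P ] when (does (fits? I τ P S)) (weight S ⊛ factorSum Q (residual τ S))
factorSum-++ P Q I τ shared⊆I I⊆Q = begin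
  factorSum (P ++ Q) τ
    ≈⟨ factorSum-∑ (P ++ Q) τ ⟩
  ∑[ S ← subsets (P ++ Q) ] when (isF (P ++ Q) τ S) (weight S)
    ≈⟨ ∑-subsets-++ P Q _ ⟩
  ∑[ S₁ ← subsets P ] ∑[ S₂ ← subsets Q ] when (isF (P ++ Q) τ (S₁ ++ S₂)) (weight (S₁ ++ S₂))
    ≈⟨ ∑-cong (subsets P) (λ S₁∈ → ∑-cong (subsets Q) (λ S₂∈ → split S₁∈ S₂∈)) ⟩
  ∑[ S₁ ← subsets P ] ∑[ S₂ ← subsets Q ] when (fits S₁) (weight S₁ ⊛ when (isF Q (τ′ S₁) S₂) (weight S₂))
    ≈⟨ ∑-cong (subsets P) (λ {S₁} _ → ∑-when (fits S₁) (weight S₁) (subsets Q) _) ⟩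
  ∑[ S₁ ← subsets P ] when (fits S₁) (weight S₁ ⊛ (∑[ S₂ ← subsets Q ] when (isF Q (τ′ S₁) S₂) (weight S₂)))
    ≈⟨ ∑-cong (subsets P) (λ {S₁} _ →
         when-cong (fits S₁) (ℒ.*-congˡ {weight S₁} (ℒ.sym (factorSum-∑ Q (τ′ S₁))))) ⟩
  ∑[ S ← subsets P ] when (fits S) (weight S ⊛ factorSum Q (residual τ S)) ∎
  where
  open ≃-Reasoning
  fits : List Edge → Bool
  fits S = does (fits? I τ P S)
  isF : List Edge → (Vertex → ℕ) → List Edge → Bool
  isF E τ S = does (isFactor? E τ S)
  τ′ : List Edge → Vertex → ℕ
  τ′ = residual τ
  split : ∀ {S₁ S₂} → S₁ ∈ subsets P → S₂ ∈ subsets Q →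
    when (isF (P ++ Q) τ (S₁ ++ S₂)) (weight (S₁ ++ S₂))
      ≃ when (fits S₁) (weight S₁ ⊛ when (isF Q (τ′ S₁) S₂) (weight S₂))
  split {S₁} {S₂} S₁∈ S₂∈ = begin
    when (isF (P ++ Q) τ (S₁ ++ S₂)) (weight (S₁ ++ S₂))
      ≈⟨ when-⇔ (isFactor? (P ++ Q) τ (S₁ ++ S₂)) (fits? I τ P S₁ ×-dec isFactor? Q (τ′ S₁) S₂)
                (isFactor-++⇔ shared⊆I I⊆Q (∈-subsets⇒⊆ P S₁∈) (∈-subsets⇒⊆ Q S₂∈)) (weight-++ S₁ S₂) ⟩
    when (fits S₁ ∧ isF Q (τ′ S₁) S₂) (weight S₁ ⊛ weight S₂)
      ≈⟨ nest (fits S₁) (isF Q (τ′ S₁) S₂) ⟩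
    when (fits S₁) (weight S₁ ⊛ when (isF Q (τ′ S₁) S₂) (weight S₂)) ∎
    where
    nest : ∀ b b′ → when (b ∧ b′) (weight S₁ ⊛ weight S₂) ≃ when b (weight S₁ ⊛ when b′ (weight S₂))
    nest true  true  = ℒ.refl
    nest true  false = ℒ.sym (ℒ.zeroʳ (weight S₁))
    nest false b′    = ℒ.refl

factorSum-congʳ : ∀ E {τ τ′} → (∀ {p} → p ∈ vertices E → τ p ≡ τ′ p) →
                  factorSum E τ ≃ factorSum E τ′
factorSum-congʳ E {τ} {τ′} τ≗τ′ = begin
  factorSum E τ                                               ≈⟨ factorSum-∑ E τ ⟩
  ∑[ S ← subsets E ] when (does (isFactor? E τ S)) (weight S)
    ≈⟨ ∑-cong (subsets E) (λ {S} _ → when-⇔ (isFactor? E τ S) (isFactor? E τ′ S) (same S) ℒ.refl) ⟩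
  ∑[ S ← subsets E ] when (does (isFactor? E τ′ S)) (weight S) ≈⟨ factorSum-∑ E τ′ ⟨
  factorSum E τ′                                              ∎
  where
  open ≃-Reasoning
  same : ∀ S → IsFactor E τ S ⇔ IsFactor E τ′ S
  same S = mk⇔ (λ h → All.tabulate λ p∈E → trans (All.lookup h p∈E) (τ≗τ′ p∈E))
               (λ h → All.tabulate λ p∈E → trans (All.lookup h p∈E) (sym (τ≗τ′ p∈E)))

translateᵥ : ℕ → ℕ → Vertex → Vertex
translateᵥ dx dy (a , b) = dx + a , dy + b

translate : ℕ → ℕ → Edge → Edge
translate dx dy (edge u v w) = edge (translateᵥ dx dy u) (translateᵥ dx dy v) w

translateᵥ-injective : ∀ dx dy {p p′} → translateᵥ dx dy p ≡ translateᵥ dx dy p′ → p ≡ p′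
translateᵥ-injective dx dy {a , b} {c , d} eq =
  cong₂ _,_ (+-cancelˡ-≡ dx a c (cong proj₁ eq)) (+-cancelˡ-≡ dy b d (cong proj₂ eq))

+-≡ᵇ-cancelˡ : ∀ d a c → (d + a ≡ᵇ d + c) ≡ (a ≡ᵇ c)
+-≡ᵇ-cancelˡ zero    a c = refl
+-≡ᵇ-cancelˡ (suc d) a c = +-≡ᵇ-cancelˡ d a c

incident-translate : ∀ dx dy p e → incident (translateᵥ dx dy p) (translate dx dy e) ≡ incident p e
incident-translate dx dy (a , b) (edge (c , d) (c′ , d′) _) =
  cong₂ _∨_ (cong₂ _∧_ (+-≡ᵇ-cancelˡ dx a c) (+-≡ᵇ-cancelˡ dy b d))
            (cong₂ _∧_ (+-≡ᵇ-cancelˡ dx a c′) (+-≡ᵇ-cancelˡ dy b d′))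

degreeIn-translate : ∀ dx dy S p → degreeIn (map (translate dx dy) S) (translateᵥ dx dy p) ≡ degreeIn S p
degreeIn-translate dx dy []      p = refl
degreeIn-translate dx dy (e ∷ S) p rewrite incident-translate dx dy p e with incident p e
... | true  = cong suc (degreeIn-translate dx dy S p)
... | false = degreeIn-translate dx dy S p

vertices-translate : ∀ dx dy E → vertices (map (translate dx dy) E) ≡ map (translateᵥ dx dy) (vertices E)
vertices-translate dx dy []               = refl
vertices-translate dx dy (edge u v _ ∷ E) =
  cong (λ vs → translateᵥ dx dy u ∷ translateᵥ dx dy v ∷ vs) (vertices-translate dx dy E)

weight-translate : ∀ dx dy S → weight (map (translate dx dy) S) ≡ weight S
weight-translate dx dy []      = refl
weight-translate dx dy (e ∷ S) = cong (Edge.wt e ⊛_) (weight-translate dx dy S)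

subsets-map : ∀ f E → subsets (map f E) ≡ map (map f) (subsets E)
subsets-map f []      = refl
subsets-map f (e ∷ E) = begin
  map (f e ∷_) (subsets (map f E)) ++ subsets (map f E)
    ≡⟨ cong (λ r → map (f e ∷_) r ++ r) (subsets-map f E) ⟩
  map (f e ∷_) (map (map f) (subsets E)) ++ map (map f) (subsets E)
    ≡⟨ cong (_++ map (map f) (subsets E)) (trans (sym (map-∘ (subsets E))) (map-∘ (subsets E))) ⟩
  map (map f) (map (e ∷_) (subsets E)) ++ map (map f) (subsets E)
    ≡⟨ map-++ (map f) (map (e ∷_) (subsets E)) (subsets E) ⟨
  map (map f) (map (e ∷_) (subsets E) ++ subsets E) ∎
  where open ≡-Reasoning

factorSum-translate : ∀ dx dy E τ →
  factorSum (map (translate dx dy) E) τ ≃ factorSum E (τ ∘ translateᵥ dx dy)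
factorSum-translate dx dy E τ = begin
  factorSum (map tr E) τ
    ≈⟨ factorSum-∑ (map tr E) τ ⟩
  ∑[ S ← subsets (map tr E) ] when (does (isFactor? (map tr E) τ S)) (weight S)
    ≡⟨ cong (λ Ss → ∑[ S ← Ss ] when (does (isFactor? (map tr E) τ S)) (weight S)) (subsets-map tr E) ⟩
  ∑[ S ← map (map tr) (subsets E) ] when (does (isFactor? (map tr E) τ S)) (weight S)
    ≡⟨ ∑-map (map tr) (subsets E) _ ⟩
  ∑[ S ← subsets E ] when (does (isFactor? (map tr E) τ (map tr S))) (weight (map tr S))
    ≈⟨ ∑-cong (subsets E) (λ {S} _ →
         when-⇔ (isFactor? (map tr E) τ (map tr S)) (isFactor? E (τ ∘ trᵥ) S)
                (translated S) (ℒ.reflexive (weight-translate dx dy S))) ⟩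
  ∑[ S ← subsets E ] when (does (isFactor? E (τ ∘ trᵥ) S)) (weight S)
    ≈⟨ factorSum-∑ E (τ ∘ trᵥ) ⟨
  factorSum E (τ ∘ trᵥ) ∎
  where
  open ≃-Reasoning
  tr : Edge → Edge
  tr = translate dx dy
  trᵥ : Vertex → Vertex
  trᵥ = translateᵥ dx dy
  translated : ∀ S → IsFactor (map tr E) τ (map tr S) ⇔ IsFactor E (τ ∘ trᵥ) S
  translated S rewrite vertices-translate dx dy E = mk⇔
    (All.map (λ {p} h → trans (sym (degreeIn-translate dx dy S p)) h) ∘ All.map⁻)
    (All.map⁺ ∘ All.map (λ {p} h → trans (degreeIn-translate dx dy S p) h))

-- Snake graphs

pieceA-translate : ∀ f x y → pieceA f x y ≡ map (translate x y) (pieceA f 0 0)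
pieceA-translate true  x y rewrite +-identityʳ x | +-identityʳ y | +-comm x 1 | +-comm x 2 | +-comm y 1 = refl
pieceA-translate false x y rewrite +-identityʳ x | +-identityʳ y | +-comm x 1 | +-comm x 2 | +-comm y 1 = refl

pieceB-translate : ∀ f x y → pieceB f x y ≡ map (translate x y) (pieceB f 0 0)
pieceB-translate true  x y
  rewrite +-identityʳ x | +-identityʳ y | +-comm x 1 | +-comm x 2 | +-comm y 1 | +-comm y 2 | +-comm y 3 = refl
pieceB-translate false x y
  rewrite +-identityʳ x | +-identityʳ y | +-comm x 1 | +-comm x 2 | +-comm y 1 | +-comm y 2 | +-comm y 3 = refl

finalB-translate : ∀ f x y → finalB f x y ≡ map (translate x y) (finalB f 0 0)
finalB-translate true  x y rewrite +-identityʳ x | +-identityʳ y | +-comm x 1 | +-comm y 1 = refl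
finalB-translate false x y rewrite +-identityʳ x | +-identityʳ y | +-comm x 1 | +-comm y 1 = refl

translate-translate : ∀ x y x′ y′ e → translate x y (translate x′ y′ e) ≡ translate (x + x′) (y + y′) e
translate-translate x y x′ y′ (edge (a , b) (c , d) w)
  rewrite +-assoc x x′ a | +-assoc y y′ b | +-assoc x x′ c | +-assoc y y′ d = refl

map-translate-translate : ∀ x y x′ y′ E →
  map (translate x y) (map (translate x′ y′) E) ≡ map (translate (x + x′) (y + y′)) E
map-translate-translate x y x′ y′ []      = refl
map-translate-translate x y x′ y′ (e ∷ E) =
  cong₂ _∷_ (translate-translate x y x′ y′ e) (map-translate-translate x y x′ y′ E)

snakeEdges-translate : ∀ f x y ws → snakeEdges f x y ws ≡ map (translate x y) (snakeEdges f 0 0 ws)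
snakeEdges-translate f x y []           = refl
snakeEdges-translate f x y (B ∷ [])     = finalB-translate f x y
snakeEdges-translate f x y (A ∷ ws)     = begin
  pieceA f x y ++ snakeEdges false (x + 2) y ws
    ≡⟨ cong₂ _++_ (pieceA-translate f x y) (snakeEdges-translate false (x + 2) y ws) ⟩
  map (translate x y) (pieceA f 0 0) ++ map (translate (x + 2) y) (snakeEdges false 0 0 ws)
    ≡⟨ cong (λ z → map (translate x y) (pieceA f 0 0) ++ map (translate (x + 2) z) (snakeEdges false 0 0 ws))
            (+-identityʳ y) ⟨
  map (translate x y) (pieceA f 0 0) ++ map (translate (x + 2) (y + 0)) (snakeEdges false 0 0 ws)
    ≡⟨ cong (map (translate x y) (pieceA f 0 0) ++_) (map-translate-translate x y 2 0 _) ⟨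
  map (translate x y) (pieceA f 0 0) ++ map (translate x y) (map (translate 2 0) (snakeEdges false 0 0 ws))
    ≡⟨ cong (λ E → map (translate x y) (pieceA f 0 0) ++ map (translate x y) E)
            (snakeEdges-translate false 2 0 ws) ⟨
  map (translate x y) (pieceA f 0 0) ++ map (translate x y) (snakeEdges false 2 0 ws)
    ≡⟨ map-++ (translate x y) (pieceA f 0 0) _ ⟨
  map (translate x y) (pieceA f 0 0 ++ snakeEdges false 2 0 ws) ∎
  where open ≡-Reasoning
snakeEdges-translate f x y (B ∷ w ∷ ws) = begin
  pieceB f x y ++ snakeEdges false (x + 2) (y + 2) (w ∷ ws)
    ≡⟨ cong₂ _++_ (pieceB-translate f x y) (snakeEdges-translate false (x + 2) (y + 2) (w ∷ ws)) ⟩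
  map (translate x y) (pieceB f 0 0) ++ map (translate (x + 2) (y + 2)) (snakeEdges false 0 0 (w ∷ ws))
    ≡⟨ cong (map (translate x y) (pieceB f 0 0) ++_) (map-translate-translate x y 2 2 _) ⟨
  map (translate x y) (pieceB f 0 0) ++ map (translate x y) (map (translate 2 2) (snakeEdges false 0 0 (w ∷ ws)))
    ≡⟨ cong (λ E → map (translate x y) (pieceB f 0 0) ++ map (translate x y) E)
            (snakeEdges-translate false 2 2 (w ∷ ws)) ⟨
  map (translate x y) (pieceB f 0 0) ++ map (translate x y) (snakeEdges false 2 2 (w ∷ ws))
    ≡⟨ map-++ (translate x y) (pieceB f 0 0) _ ⟨
  map (translate x y) (pieceB f 0 0 ++ snakeEdges false 2 2 (w ∷ ws)) ∎
  where open ≡-Reasoning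

demand : Bool → ℕ
demand true  = 1
demand false = 0

-- Degrees demanded of a snake whose two leftmost vertices (0,0) and (0,1) may already be covered
-- by the previous piece; true means still to be covered.
profile : Bool → Bool → Vertex → ℕ
profile b b′ p = if p ==ᵥ (0 , 0) then demand b else if p ==ᵥ (0 , 1) then demand b′ else 1

snake : List AB → List Edge
snake = snakeEdges false 0 0

snakeSum : List AB → Bool → Bool → LP
snakeSum ws b b′ = factorSum (snake ws) (profile b b′)

interface : ℕ → List Vertex
interface y₀ = map (translateᵥ 2 y₀) ((0 , 0) ∷ (0 , 1) ∷ [])

LeftOfInterface : ℕ → List Edge → Set
LeftOfInterface y₀ P = All (λ p → p ∈ interface y₀ ⊎ proj₁ p < 2) (vertices P)

leftOfInterface? : ∀ y₀ P → Dec (LeftOfInterface y₀ P)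
leftOfInterface? y₀ P = all? (λ p → (p ∈? interface y₀) ⊎-dec (proj₁ p <? 2)) (vertices P)

uncovered : Vertex → List Edge → Bool
uncovered i S = degreeIn S i ≡ᵇ 0

pieceWeights : List Edge → ℕ → (Vertex → ℕ) → Bool → Bool → LP
pieceWeights P y₀ τ = bucket (subsets P) (λ S → when (does (fits? (interface y₀) τ P S)) (weight S))
                             (uncovered (translateᵥ 2 y₀ (0 , 0))) (uncovered (translateᵥ 2 y₀ (0 , 1)))

1∸n≡demand : ∀ n → 1 ∸ n ≡ demand (n ≡ᵇ 0)
1∸n≡demand zero    = refl
1∸n≡demand (suc n) = 0∸n≡0 n

module _ (P : List Edge) (y₀ : ℕ) (τ : Vertex → ℕ) (Q₀ : List Edge)
         (left : LeftOfInterface y₀ P) (00∈Q₀ : (0 , 0) ∈ vertices Q₀) (01∈Q₀ : (0 , 1) ∈ vertices Q₀)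
         (τ≡1 : ∀ p → τ (translateᵥ 2 y₀ p) ≡ 1) where

  private
    trᵥ : Vertex → Vertex
    trᵥ = translateᵥ 2 y₀
    Q : List Edge
    Q = map (translate 2 y₀) Q₀

    right : ∀ {p} → p ∈ vertices Q → 2 ≤ proj₁ p
    right p∈Q with ∈-map⁻ trᵥ (subst (_ ∈_) (vertices-translate 2 y₀ Q₀) p∈Q)
    ... | (a , _) , _ , refl = m≤m+n 2 a

    shared⊆interface : ∀ {p} → p ∈ vertices P → p ∈ vertices Q → p ∈ interface y₀
    shared⊆interface p∈P p∈Q with All.lookup left p∈P
    ... | inj₁ p∈I = p∈I
    ... | inj₂ p<2 = contradiction (right p∈Q) (<⇒≱ p<2)

    interface⊆Q : ∀ {p} → p ∈ interface y₀ → p ∈ vertices Q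
    interface⊆Q p∈I = subst (_ ∈_) (sym (vertices-translate 2 y₀ Q₀)) (lemma p∈I)
      where
      lemma : ∀ {p} → p ∈ interface y₀ → p ∈ map trᵥ (vertices Q₀)
      lemma (here refl)         = ∈-map⁺ trᵥ 00∈Q₀
      lemma (there (here refl)) = ∈-map⁺ trᵥ 01∈Q₀

    residual≡profile : ∀ {S} → S ⊆ P → ∀ p →
      residual τ S (trᵥ p) ≡ profile (uncovered (trᵥ (0 , 0)) S) (uncovered (trᵥ (0 , 1)) S) p
    residual≡profile {S} S⊆P p with p ==ᵥ (0 , 0) in p=00 | p ==ᵥ (0 , 1) in p=01
    ... | true  | _ rewrite ==ᵥ⇒≡ p (0 , 0) (Equivalence.from T-≡ p=00) | τ≡1 (0 , 0) =
      1∸n≡demand (degreeIn S (trᵥ (0 , 0)))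
    ... | false | true rewrite ==ᵥ⇒≡ p (0 , 1) (Equivalence.from T-≡ p=01) | τ≡1 (0 , 1) =
      1∸n≡demand (degreeIn S (trᵥ (0 , 1)))
    ... | false | false = cong₂ _∸_ (τ≡1 p) (degreeIn-outside S⊆P trp∉P)
      where
      notInterface : trᵥ p ∉ interface y₀
      notInterface (here eq) =
        contradiction (subst (λ q → (q ==ᵥ (0 , 0)) ≡ false) (translateᵥ-injective 2 y₀ eq) p=00) λ ()
      notInterface (there (here eq)) =
        contradiction (subst (λ q → (q ==ᵥ (0 , 1)) ≡ false) (translateᵥ-injective 2 y₀ eq) p=01) λ ()
      trp∉P : trᵥ p ∉ vertices P
      trp∉P trp∈P with All.lookup left trp∈P
      ... | inj₁ trp∈I          = notInterface trp∈I
      ... | inj₂ (s≤s (s≤s ()))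

  factorSum-piece :
    factorSum (P ++ map (translate 2 y₀) Q₀) τ ≃
      (pieceWeights P y₀ τ true true ⊛ factorSum Q₀ (profile true true)
        ⊕ pieceWeights P y₀ τ true false ⊛ factorSum Q₀ (profile true false))
      ⊕ (pieceWeights P y₀ τ false true ⊛ factorSum Q₀ (profile false true)
        ⊕ pieceWeights P y₀ τ false false ⊛ factorSum Q₀ (profile false false))
  factorSum-piece = begin
    factorSum (P ++ Q) τ
      ≈⟨ factorSum-++ P Q (interface y₀) τ shared⊆interface interface⊆Q ⟩
    ∑[ S ← subsets P ] when (fits S) (weight S ⊛ factorSum Q (residual τ S))
      ≈⟨ ∑-cong (subsets P) (λ {S} S∈ → when-cong (fits S) (ℒ.*-congˡ {weight S} (residual-sum S∈))) ⟩
    ∑[ S ← subsets P ] when (fits S) (weight S ⊛ G (k₁ S) (k₂ S))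
      ≈⟨ ∑-cong (subsets P) (λ {S} _ → when-⊛ʳ (fits S) (weight S) (G (k₁ S) (k₂ S))) ⟩
    ∑[ S ← subsets P ] when (fits S) (weight S) ⊛ G (k₁ S) (k₂ S)
      ≈⟨ ∑-split₂ (subsets P) (λ S → when (fits S) (weight S)) k₁ k₂ G ⟩
    _ ∎
    where
    open ≃-Reasoning
    fits : List Edge → Bool
    fits S = does (fits? (interface y₀) τ P S)
    k₁ k₂ : List Edge → Bool
    k₁ = uncovered (trᵥ (0 , 0))
    k₂ = uncovered (trᵥ (0 , 1))
    G : Bool → Bool → LP
    G b b′ = factorSum Q₀ (profile b b′)
    residual-sum : ∀ {S} → S ∈ subsets P → factorSum Q (residual τ S) ≃ G (k₁ S) (k₂ S)
    residual-sum {S} S∈ = ℒ.trans (factorSum-translate 2 y₀ Q₀ (residual τ S))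
                                  (factorSum-congʳ Q₀ (λ {p} _ → residual≡profile (∈-subsets⇒⊆ P S∈) p))

-- A fitting edge set of a snake piece covers an even number of vertices, hence both interface
-- vertices or neither: the mixed weights vanish.
pieceRow : ∀ P y₀ τ Q₀ a d →
  (0 , 0) ∈ vertices Q₀ → (0 , 1) ∈ vertices Q₀ → (∀ p → τ (translateᵥ 2 y₀ p) ≡ 1) →
  True (leftOfInterface? y₀ P) →
  T (pieceWeights P y₀ τ true true ≃ᵇ a) → T (pieceWeights P y₀ τ true false ≃ᵇ 𝟘) →
  T (pieceWeights P y₀ τ false true ≃ᵇ 𝟘) → T (pieceWeights P y₀ τ false false ≃ᵇ d) →
  factorSum (P ++ map (translate 2 y₀) Q₀) τ
    ≃ a ⊛ factorSum Q₀ (profile true true) ⊕ d ⊛ factorSum Q₀ (profile false false)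
pieceRow P y₀ τ Q₀ a d 00∈Q₀ 01∈Q₀ τ≡1 left tt≃a tf≃0 ft≃0 ff≃d = begin
  factorSum (P ++ map (translate 2 y₀) Q₀) τ
    ≈⟨ factorSum-piece P y₀ τ Q₀ (toWitness {a? = leftOfInterface? y₀ P} left) 00∈Q₀ 01∈Q₀ τ≡1 ⟩
  (K true true ⊛ G true true ⊕ K true false ⊛ G true false)
    ⊕ (K false true ⊛ G false true ⊕ K false false ⊛ G false false)
    ≈⟨ ℒ.+-cong (ℒ.+-cong (weight≃ tt≃a) (weight≃ tf≃0)) (ℒ.+-cong (weight≃ ft≃0) (weight≃ ff≃d)) ⟩
  (a ⊛ G true true ⊕ 𝟘 ⊛ G true false) ⊕ (𝟘 ⊛ G false true ⊕ d ⊛ G false false)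
    ≈⟨ solve 6 (λ a d x y z u → (a :* x :+ con 0 :* y) :+ (con 0 :* z :+ d :* u) := a :* x :+ d :* u)
             ℒ.refl a d (G true true) (G true false) (G false true) (G false false) ⟩
  a ⊛ G true true ⊕ d ⊛ G false false ∎
  where
  open ≃-Reasoning
  open LP-Solver using (solve; _:+_; _:*_; _:=_; con)
  K : Bool → Bool → LP
  K = pieceWeights P y₀ τ
  G : Bool → Bool → LP
  G b b′ = factorSum Q₀ (profile b b′)
  weight≃ : ∀ {b b′ c} → T (K b b′ ≃ᵇ c) → K b b′ ⊛ G b b′ ≃ c ⊛ G b b′
  weight≃ {b} {b′} {c} h = ℒ.*-congʳ (≃ᵇ⇒≃ (K b b′) c h)

snake-firstVertices : ∀ w ws → (0 , 0) ∈ vertices (snake (w ∷ ws)) × (0 , 1) ∈ vertices (snake (w ∷ ws))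
snake-firstVertices A ws       = here refl , there (there (there (there (here refl))))
snake-firstVertices B []       = here refl , there (there (here refl))
snake-firstVertices B (w ∷ ws) = here refl , there (there (here refl))

piece : AB → List Edge
piece A = pieceA false 0 0
piece B = pieceB false 0 0

rise : AB → ℕ
rise A = 0
rise B = 2

snake-∷ : ∀ v w ws → snake (v ∷ w ∷ ws) ≡ piece v ++ map (translate 2 (rise v)) (snake (w ∷ ws))
snake-∷ A w ws = cong (pieceA false 0 0 ++_) (snakeEdges-translate false 2 0 (w ∷ ws))
snake-∷ B w ws = cong (pieceB false 0 0 ++_) (snakeEdges-translate false 2 2 (w ∷ ws))

snakeSum-∷ : ∀ v w ws b b′ a d → True (leftOfInterface? (rise v) (piece v)) →
  T (pieceWeights (piece v) (rise v) (profile b b′) true true ≃ᵇ a) →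
  T (pieceWeights (piece v) (rise v) (profile b b′) true false ≃ᵇ 𝟘) →
  T (pieceWeights (piece v) (rise v) (profile b b′) false true ≃ᵇ 𝟘) →
  T (pieceWeights (piece v) (rise v) (profile b b′) false false ≃ᵇ d) →
  snakeSum (v ∷ w ∷ ws) b b′ ≃ a ⊛ snakeSum (w ∷ ws) true true ⊕ d ⊛ snakeSum (w ∷ ws) false false
snakeSum-∷ v w ws b b′ a d left tt≃a tf≃0 ft≃0 ff≃d =
  subst (λ E → factorSum E (profile b b′) ≃ a ⊛ snakeSum (w ∷ ws) true true ⊕ d ⊛ snakeSum (w ∷ ws) false false)
    (sym (snake-∷ v w ws))
        (pieceRow (piece v) (rise v) (profile b b′) (snake (w ∷ ws)) a d
                  (proj₁ (snake-firstVertices w ws)) (proj₂ (snake-firstVertices w ws)) (λ _ → refl)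
                  left tt≃a tf≃0 ft≃0 ff≃d)

matchingVector : List AB → V2
matchingVector ws = vec (snakeSum ws true true) (snakeSum ws false false)

matchingVector-∷ : ∀ v w ws →
  matchingVector (v ∷ w ∷ ws) ≃ⱽ transpose (letterMatrix v) · matchingVector (w ∷ ws)
matchingVector-∷ A w ws = mk≃ⱽ (snakeSum-∷ A w ws true true (M2.m11 A1) (M2.m21 A1) _ _ _ _ _)
                               (snakeSum-∷ A w ws false false (M2.m12 A1) (M2.m22 A1) _ _ _ _ _)
matchingVector-∷ B w ws = mk≃ⱽ (snakeSum-∷ B w ws true true (M2.m11 B1) (M2.m21 B1) _ _ _ _ _)
                               (snakeSum-∷ B w ws false false (M2.m12 B1) (M2.m22 B1) _ _ _ _ _)

data EndsWithB : List AB → Set where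
  [B] : EndsWithB (B ∷ [])
  _∷_ : ∀ w {ws} → EndsWithB ws → EndsWithB (w ∷ ws)

EndsWithB-++ : ∀ u {v} → EndsWithB v → EndsWithB (u ++ v)
EndsWithB-++ []      e = e
EndsWithB-++ (w ∷ u) e = w ∷ EndsWithB-++ u e

-- q⁻¹ [[1, 1], [1, q⁻¹(1+q)]]
basisChange : M2
basisChange = mat qinv qinv qinv (lp 2 (1 ∷ 1 ∷ []))

intertwine : ∀ w → letterMatrix w ⊗ basisChange ≃ᴹ basisChange ⊗ transpose (letterMatrix w)
intertwine A = mk≃ᴹ (≃ᵇ⇒≃ _ _ _) (≃ᵇ⇒≃ _ _ _) (≃ᵇ⇒≃ _ _ _) (≃ᵇ⇒≃ _ _ _)
intertwine B = mk≃ᴹ (≃ᵇ⇒≃ _ _ _) (≃ᵇ⇒≃ _ _ _) (≃ᵇ⇒≃ _ _ _) (≃ᵇ⇒≃ _ _ _)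

rightColumn-wordMatrix : ∀ ws → EndsWithB ws → rightColumn (wordMatrix ws) ≃ⱽ basisChange · matchingVector ws
rightColumn-wordMatrix (B ∷ []) [B] = begin
  rightColumn (B1 ⊗ I₂)
    ≈⟨ mk≃ⱽ (≃ᵇ⇒≃ (M2.m12 (B1 ⊗ I₂)) (V2.top (basisChange · vec qq 𝟙)) _)
            (≃ᵇ⇒≃ (M2.m22 (B1 ⊗ I₂)) (V2.bottom (basisChange · vec qq 𝟙)) _) ⟩
  basisChange · vec qq 𝟙
    ≈⟨ ·-cong (≃ᴹ-refl {basisChange})
              (mk≃ⱽ (≃ᵇ⇒≃ qq (snakeSum (B ∷ []) true true) _) (≃ᵇ⇒≃ 𝟙 (snakeSum (B ∷ []) false false) _)) ⟩
  basisChange · matchingVector (B ∷ []) ∎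
  where open ≃ⱽ-Reasoning
rightColumn-wordMatrix (v ∷ w ∷ ws) (.v ∷ e) = begin
  letterMatrix v · rightColumn (wordMatrix (w ∷ ws))
    ≈⟨ ·-cong (≃ᴹ-refl {letterMatrix v}) (rightColumn-wordMatrix (w ∷ ws) e) ⟩
  letterMatrix v · basisChange · matchingVector (w ∷ ws)
    ≈⟨ ⊗-· (letterMatrix v) basisChange (matchingVector (w ∷ ws)) ⟨
  (letterMatrix v ⊗ basisChange) · matchingVector (w ∷ ws)
    ≈⟨ ·-cong (intertwine v) ≃ⱽ-refl ⟩
  (basisChange ⊗ transpose (letterMatrix v)) · matchingVector (w ∷ ws)
    ≈⟨ ⊗-· basisChange (transpose (letterMatrix v)) (matchingVector (w ∷ ws)) ⟩
  basisChange · transpose (letterMatrix v) · matchingVector (w ∷ ws)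
    ≈⟨ ·-cong (≃ᴹ-refl {basisChange}) (matchingVector-∷ v w ws) ⟨
  basisChange · matchingVector (v ∷ w ∷ ws) ∎
  where open ≃ⱽ-Reasoning

resetFirst-translate : ∀ E → map resetFirst (map (translate 2 0) E) ≡ map (translate 2 0) E
resetFirst-translate []      = refl
resetFirst-translate (e ∷ E) = cong (translate 2 0 e ∷_) (resetFirst-translate E)

tildeSnake : ∀ w ws → map resetFirst (snakeEdges true 0 0 (A ∷ w ∷ ws))
                        ≡ map resetFirst (pieceA true 0 0) ++ map (translate 2 0) (snake (w ∷ ws))
tildeSnake w ws = begin
  map resetFirst (pieceA true 0 0 ++ snakeEdges false 2 0 (w ∷ ws))
    ≡⟨ map-++ resetFirst (pieceA true 0 0) _ ⟩
  map resetFirst (pieceA true 0 0) ++ map resetFirst (snakeEdges false 2 0 (w ∷ ws))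
    ≡⟨ cong (λ E → map resetFirst (pieceA true 0 0) ++ map resetFirst E)
            (snakeEdges-translate false 2 0 (w ∷ ws)) ⟩
  map resetFirst (pieceA true 0 0) ++ map resetFirst (map (translate 2 0) (snake (w ∷ ws)))
    ≡⟨ cong (map resetFirst (pieceA true 0 0) ++_) (resetFirst-translate (snake (w ∷ ws))) ⟩
  map resetFirst (pieceA true 0 0) ++ map (translate 2 0) (snake (w ∷ ws)) ∎
  where open ≡-Reasoning

topRight-wordMatrix : ∀ w ws → EndsWithB (w ∷ ws) →
  topRight (wordMatrix (A ∷ w ∷ ws)) ≃ matchingSum (map resetFirst (snakeEdges true 0 0 (A ∷ w ∷ ws)))
topRight-wordMatrix w ws e = begin
  topRight (wordMatrix (A ∷ w ∷ ws))
    ≡⟨⟩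
  V2.top (A1 · rightColumn (wordMatrix (w ∷ ws)))
    ≈⟨ top≃ (·-cong (≃ᴹ-refl {A1}) (rightColumn-wordMatrix (w ∷ ws) e)) ⟩
  V2.top (A1 · basisChange · matchingVector (w ∷ ws))
    ≈⟨ top≃ (⊗-· A1 basisChange (matchingVector (w ∷ ws))) ⟨
  M2.m11 (A1 ⊗ basisChange) ⊛ snakeSum (w ∷ ws) true true
    ⊕ M2.m12 (A1 ⊗ basisChange) ⊛ snakeSum (w ∷ ws) false false
    ≈⟨ ℒ.+-cong (ℒ.*-congʳ {snakeSum (w ∷ ws) true true} (≃ᵇ⇒≃ (M2.m11 (A1 ⊗ basisChange)) r _))
                (ℒ.*-congʳ {snakeSum (w ∷ ws) false false} (≃ᵇ⇒≃ (M2.m12 (A1 ⊗ basisChange)) r′ _)) ⟩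
  r ⊛ snakeSum (w ∷ ws) true true ⊕ r′ ⊛ snakeSum (w ∷ ws) false false
    ≈⟨ pieceRow (map resetFirst (pieceA true 0 0)) 0 (λ _ → 1) (snake (w ∷ ws)) r r′
                (proj₁ (snake-firstVertices w ws)) (proj₂ (snake-firstVertices w ws)) (λ _ → refl) _ _ _ _ _ ⟨
  factorSum (map resetFirst (pieceA true 0 0) ++ map (translate 2 0) (snake (w ∷ ws))) (λ _ → 1)
    ≡⟨ cong (λ E → factorSum E (λ _ → 1)) (tildeSnake w ws) ⟨
  factorSum (map resetFirst (snakeEdges true 0 0 (A ∷ w ∷ ws))) (λ _ → 1)
    ≡⟨⟩
  matchingSum (map resetFirst (snakeEdges true 0 0 (A ∷ w ∷ ws))) ∎
  where
  open ≃-Reasoning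
  r r′ : LP
  r  = lp 1 (1 ∷ 1 ∷ [])
  r′ = lp 2 (1 ∷ 1 ∷ 1 ∷ [])

-- Christoffel words of Farey mediants

/-≡-bounds : ∀ {x n a} .{{_ : NonZero n}} → a * n ≤ x → x < suc a * n → x / n ≡ a
/-≡-bounds {x} {n} {a} lo hi = ≤-antisym (≤-pred (m<n*o⇒m/o<n hi)) (begin
  a          ≡⟨ m*n/n≡m a n ⟨
  a * n / n  ≤⟨ /-monoˡ-≤ n lo ⟩
  x / n      ∎)
  where open ≤-Reasoning

-- The Farey determinant puts both halves of the Christoffel word of a mediant in this form.
/-transfer : ∀ {x y m n e f} .{{_ : NonZero m}} .{{_ : NonZero n}} →
             e ≤ f → f < n → x * m + e ≡ y * n + f → x / n ≡ y / m
/-transfer {x} {y} {m} {n} {e} {f} e≤f f<n eq = /-≡-bounds lower upper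
  where
  open ≤-Reasoning
  a : ℕ
  a = y / m
  yn≤xm : y * n ≤ x * m
  yn≤xm = +-cancelʳ-≤ e (y * n) (x * m) (begin
    y * n + e  ≤⟨ +-monoʳ-≤ (y * n) e≤f ⟩
    y * n + f  ≡⟨ eq ⟨
    x * m + e  ∎)
  y<[1+a]m : y < suc a * m
  y<[1+a]m = begin-strict
    y              ≡⟨ m≡m%n+[m/n]*n y m ⟩
    y % m + a * m  <⟨ +-monoˡ-< (a * m) (m%n<n y m) ⟩
    suc a * m      ∎
  lower : a * n ≤ x
  lower = *-cancelʳ-≤ (a * n) x m (begin
    a * n * m  ≡⟨ xy∙z≈xz∙y a n m ⟩
    a * m * n  ≤⟨ *-monoˡ-≤ n (m/n*n≤m y m) ⟩
    y * n      ≤⟨ yn≤xm ⟩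
    x * m      ∎)
  upper : x < suc a * n
  upper = *-cancelʳ-< m x (suc a * n) (begin-strict
    x * m          ≤⟨ m≤m+n (x * m) e ⟩
    x * m + e      ≡⟨ eq ⟩
    y * n + f      <⟨ +-monoʳ-< (y * n) f<n ⟩
    y * n + n      ≡⟨ +-comm (y * n) n ⟩
    suc y * n      ≤⟨ *-monoˡ-≤ n y<[1+a]m ⟩
    suc a * m * n  ≡⟨ xy∙z≈xz∙y (suc a) m n ⟩
    suc a * n * m  ∎)

applyUpTo-++ : ∀ {A : Set} (f : ℕ → A) m n → applyUpTo f (m + n) ≡ applyUpTo f m ++ applyUpTo (f ∘ (m +_)) n
applyUpTo-++ f zero    n = refl
applyUpTo-++ f (suc m) n = cong (f 0 ∷_) (applyUpTo-++ (f ∘ suc) m n)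

applyUpTo-cong : ∀ {A : Set} {f g : ℕ → A} n → (∀ {j} → j < n → f j ≡ g j) →
                 applyUpTo f n ≡ applyUpTo g n
applyUpTo-cong zero    f≗g = refl
applyUpTo-cong (suc n) f≗g = cong₂ _∷_ (f≗g z<s) (applyUpTo-cong n (f≗g ∘ s≤s))

letter : (k N : ℕ) .{{_ : NonZero N}} → ℕ → XY
letter k N j = if (j + 1) * k / N ≡ᵇ j * k / N then X else Y

christoffel-letters : ∀ k s (k+s>0 : 0 < k + s) →
  christoffel k s ≡ applyUpTo (letter k (k + s) {{>-nonZero k+s>0}}) (k + s)
christoffel-letters zero    (suc s) _ = map-upTo _ (suc s)
christoffel-letters (suc k) s       _ = map-upTo _ (suc (k + s))

christoffel-head : ∀ k s → 0 < s → ∃ λ v → christoffel k s ≡ X ∷ v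
christoffel-head k (suc s) _ = rest , (begin
  christoffel k (suc s)       ≡⟨ christoffel-letters k (suc s) N>0 ⟩
  applyUpTo (letter k N) N    ≡⟨ cong (applyUpTo (letter k N)) (+-suc k s) ⟩
  letter k N 0 ∷ rest         ≡⟨ cong (_∷ rest) first ⟩
  X ∷ rest                    ∎)
  where
  open ≡-Reasoning
  N : ℕ
  N = k + suc s
  N>0 : 0 < N
  N>0 = <-≤-trans z<s (m≤n+m (suc s) k)
  instance
    N-nonZero : NonZero N
    N-nonZero = >-nonZero N>0
  rest : List XY
  rest = applyUpTo (letter k N ∘ suc) (k + s)
  first : letter k N 0 ≡ X
  first = cong₂ (λ a b → if a ≡ᵇ b then X else Y)
                (m<n⇒m/n≡0 (subst (_< N) (sym (*-identityˡ k)) (m<m+n k z<s))) (0/n≡0 N)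

module _ {r s r′ s′ : ℕ} (neighbours : FareyNeighbours r s r′ s′) where

  private
    k N₁ N₂ N : ℕ
    k  = r + r′
    N₁ = r + s
    N₂ = r′ + s′
    N  = k + (s + s′)

    det : r′ * s ≡ r * s′ + 1
    det = proj₂ (proj₂ (proj₂ (proj₂ neighbours)))

    N₁>0 : 0 < N₁
    N₁>0 = <-≤-trans (proj₁ neighbours) (m≤n+m s r)

    N₂>0 : 0 < N₂
    N₂>0 = <-≤-trans (proj₁ (proj₂ neighbours)) (m≤n+m s′ r′)

    N≡N₁+N₂ : N ≡ N₁ + N₂
    N≡N₁+N₂ = solve 4 (λ r r′ s s′ → (r :+ r′) :+ (s :+ s′) := (r :+ s) :+ (r′ :+ s′)) refl r r′ s s′
      where open +-*-Solver using (solve; _:+_; _:=_)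

    N₁<N : N₁ < N
    N₁<N = subst (N₁ <_) (sym N≡N₁+N₂) (m<m+n N₁ N₂>0)

    N₂<N : N₂ < N
    N₂<N = subst (N₂ <_) (sym N≡N₁+N₂) (m<n+m N₂ N₁>0)

    instance
      N₁-nonZero : NonZero N₁
      N₁-nonZero = >-nonZero N₁>0
      N₂-nonZero : NonZero N₂
      N₂-nonZero = >-nonZero N₂>0
      N-nonZero : NonZero N
      N-nonZero = >-nonZero (<-trans N₁>0 N₁<N)

    kN₁ : k * N₁ ≡ r * N + 1
    kN₁ = begin
      (r + r′) * (r + s)
        ≡⟨ solve 3 (λ r r′ s → (r :+ r′) :* (r :+ s) := r :* (r :+ r′ :+ s) :+ r′ :* s) refl r r′ s ⟩
      r * (r + r′ + s) + r′ * s
        ≡⟨ cong (r * (r + r′ + s) +_) det ⟩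
      r * (r + r′ + s) + (r * s′ + 1)
        ≡⟨ solve 4 (λ r r′ s s′ → r :* (r :+ r′ :+ s) :+ (r :* s′ :+ con 1)
                                    := r :* ((r :+ r′) :+ (s :+ s′)) :+ con 1) refl r r′ s s′ ⟩
      r * N + 1 ∎
      where
      open ≡-Reasoning
      open +-*-Solver

    kN₂ : k * N₂ + 1 ≡ r′ * N
    kN₂ = begin
      (r + r′) * (r′ + s′) + 1
        ≡⟨ solve 3 (λ r r′ s′ → (r :+ r′) :* (r′ :+ s′) :+ con 1
                                  := (r :* s′ :+ con 1) :+ r′ :* (r :+ r′ :+ s′)) refl r r′ s′ ⟩
      (r * s′ + 1) + r′ * (r + r′ + s′)
        ≡⟨ cong (_+ r′ * (r + r′ + s′)) det ⟨
      r′ * s + r′ * (r + r′ + s′)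
        ≡⟨ solve 4 (λ r r′ s s′ → r′ :* s :+ r′ :* (r :+ r′ :+ s′) := r′ :* ((r :+ r′) :+ (s :+ s′))) refl r r′ s s′ ⟩
      r′ * N ∎
      where
      open ≡-Reasoning
      open +-*-Solver

    prefix : ∀ {j} → j ≤ N₁ → j * k / N ≡ j * r / N₁
    prefix {j} j≤N₁ = /-transfer z≤n (≤-<-trans j≤N₁ N₁<N) (begin
      j * k * N₁ + 0    ≡⟨ +-identityʳ _ ⟩
      j * k * N₁        ≡⟨ *-assoc j k N₁ ⟩
      j * (k * N₁)      ≡⟨ cong (j *_) kN₁ ⟩
      j * (r * N + 1)   ≡⟨ solve 3 (λ j r N → j :* (r :* N :+ con 1) := j :* r :* N :+ j) refl j r N ⟩
      j * r * N + j     ∎)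
      where
      open ≡-Reasoning
      open +-*-Solver

    suffix : ∀ {j} → j ≤ N₂ → (N₁ + j) * k / N ≡ r + j * r′ / N₂
    suffix {j} j≤N₂ = begin
      (N₁ + j) * k / N            ≡⟨ /-transfer j≤N₂ N₂<N cross ⟩
      (j * r′ + r * N₂) / N₂      ≡⟨ +-distrib-/-∣ʳ (j * r′) (divides r refl) ⟩
      j * r′ / N₂ + r * N₂ / N₂   ≡⟨ cong (j * r′ / N₂ +_) (m*n/n≡m r N₂) ⟩
      j * r′ / N₂ + r             ≡⟨ +-comm (j * r′ / N₂) r ⟩
      r + j * r′ / N₂             ∎
      where
      open ≡-Reasoning
      open +-*-Solver
      cross : (N₁ + j) * k * N₂ + j ≡ (j * r′ + r * N₂) * N + N₂
      cross = begin
        (N₁ + j) * k * N₂ + j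
          ≡⟨ solve 4 (λ N₁ j k N₂ → (N₁ :+ j) :* k :* N₂ :+ j
                                     := k :* N₁ :* N₂ :+ j :* (k :* N₂ :+ con 1)) refl N₁ j k N₂ ⟩
        k * N₁ * N₂ + j * (k * N₂ + 1)
          ≡⟨ cong₂ (λ a b → a * N₂ + j * b) kN₁ kN₂ ⟩
        (r * N + 1) * N₂ + j * (r′ * N)
          ≡⟨ solve 5 (λ r N N₂ j r′ → (r :* N :+ con 1) :* N₂ :+ j :* (r′ :* N)
                                       := (j :* r′ :+ r :* N₂) :* N :+ N₂) refl r N N₂ j r′ ⟩
        (j * r′ + r * N₂) * N + N₂ ∎

    letter-prefix : ∀ {j} → j < N₁ → letter k N j ≡ letter r N₁ j
    letter-prefix {j} j<N₁ = cong₂ (λ a b → if a ≡ᵇ b then X else Y)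
      (prefix (subst (_≤ N₁) (+-comm 1 j) j<N₁)) (prefix (<⇒≤ j<N₁))

    letter-suffix : ∀ {j} → j < N₂ → letter k N (N₁ + j) ≡ letter r′ N₂ j
    letter-suffix {j} j<N₂ = begin
      letter k N (N₁ + j)
        ≡⟨ cong₂ (λ a b → if a ≡ᵇ b then X else Y)
                 (trans (cong (λ i → i * k / N) (+-assoc N₁ j 1)) (suffix (subst (_≤ N₂) (+-comm 1 j) j<N₂)))
                 (suffix (<⇒≤ j<N₂)) ⟩
      (if r + (j + 1) * r′ / N₂ ≡ᵇ r + j * r′ / N₂ then X else Y)
        ≡⟨ cong (λ b → if b then X else Y) (+-≡ᵇ-cancelˡ r ((j + 1) * r′ / N₂) (j * r′ / N₂)) ⟩
      letter r′ N₂ j ∎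
      where open ≡-Reasoning

  christoffel-++ : christoffel (r + r′) (s + s′) ≡ christoffel r s ++ christoffel r′ s′
  christoffel-++ = begin
    christoffel k (s + s′)
      ≡⟨ christoffel-letters k (s + s′) (<-trans N₁>0 N₁<N) ⟩
    applyUpTo (letter k N) N
      ≡⟨ cong (applyUpTo (letter k N)) N≡N₁+N₂ ⟩
    applyUpTo (letter k N) (N₁ + N₂)
      ≡⟨ applyUpTo-++ (letter k N) N₁ N₂ ⟩
    applyUpTo (letter k N) N₁ ++ applyUpTo (letter k N ∘ (N₁ +_)) N₂
      ≡⟨ cong₂ _++_ (applyUpTo-cong N₁ letter-prefix) (applyUpTo-cong N₂ letter-suffix) ⟩
    applyUpTo (letter r N₁) N₁ ++ applyUpTo (letter r′ N₂) N₂
      ≡⟨ cong₂ _++_ (christoffel-letters r s N₁>0) (christoffel-letters r′ s′ N₂>0) ⟨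
    christoffel r s ++ christoffel r′ s′ ∎
    where open ≡-Reasoning

toAB-++ : ∀ u v → toAB (u ++ X ∷ v) ≡ toAB u ++ toAB (X ∷ v)
toAB-++ []           v = refl
toAB-++ (X ∷ [])     v = refl
toAB-++ (X ∷ Y ∷ u)  v = cong (B ∷_) (toAB-++ u v)
toAB-++ (X ∷ X ∷ u)  v = cong (A ∷_) (toAB-++ (X ∷ u) v)
toAB-++ (Y ∷ u)      v = toAB-++ u v

word : ℕ → ℕ → List AB
word k s = toAB (christoffel k s)

word-++ : ∀ {r s r′ s′} → FareyNeighbours r s r′ s′ → word (r + r′) (s + s′) ≡ word r s ++ word r′ s′
word-++ {r} {s} {r′} {s′} neighbours with christoffel-head r′ s′ (proj₁ (proj₂ neighbours))
... | v , w′≡Xv = begin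
  toAB (christoffel (r + r′) (s + s′))        ≡⟨ cong toAB (christoffel-++ neighbours) ⟩
  toAB (christoffel r s ++ christoffel r′ s′) ≡⟨ cong (λ w′ → toAB (christoffel r s ++ w′)) w′≡Xv ⟩
  toAB (christoffel r s ++ X ∷ v)             ≡⟨ toAB-++ (christoffel r s) v ⟩
  toAB (christoffel r s) ++ toAB (X ∷ v)      ≡⟨ cong (λ w′ → toAB (christoffel r s) ++ toAB w′) w′≡Xv ⟨
  toAB (christoffel r s) ++ toAB (christoffel r′ s′) ∎
  where open ≡-Reasoning

-- Farey parents and the matrices C_t

record FareyParents (k s : ℕ) : Set where
  constructor fareyParents
  field
    {r s₁ r′ s₂} : ℕ
    neighbours   : FareyNeighbours r s₁ r′ s₂
    k≡r+r′       : k ≡ r + r′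
    s≡s₁+s₂      : s ≡ s₁ + s₂

det⇒coprime : ∀ {r s r′ s′} → r′ * s ≡ r * s′ + 1 → Coprime r s × Coprime r′ s′
det⇒coprime {r} {s} {r′} {s′} det = left , right
  where
  left : Coprime r s
  left {d} (d∣r , d∣s) =
    ∣1⇒≡1 (∣m+n∣m⇒∣n (subst (d ∣_) det (subst (d ∣_) (*-comm s r′) (∣m⇒∣m*n r′ d∣s))) (∣m⇒∣m*n s′ d∣r))
  right : Coprime r′ s′
  right {d} (d∣r′ , d∣s′) =
    ∣1⇒≡1 (∣m+n∣m⇒∣n (subst (d ∣_) det (∣m⇒∣m*n s d∣r′)) (subst (d ∣_) (*-comm s′ r) (∣m⇒∣m*n r d∣s′)))

fareyParents-det : ∀ {k s} r s₁ r′ s₂ → 0 < s₁ → 0 < s₂ → r′ * s₁ ≡ r * s₂ + 1 →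
            k ≡ r + r′ → s ≡ s₁ + s₂ → k < s → FareyParents k s
fareyParents-det {k} {s} r s₁ r′ s₂ s₁>0 s₂>0 det k≡ s≡ k<s =
  fareyParents (s₁>0 , s₂>0 , <⇒≤ r<s₁ , r′≤s₂ , det) k≡ s≡
  where
  open ≤-Reasoning
  open +-*-Solver using (solve; _:+_; _:*_; _:=_; con)
  instance
    s-nonZero : NonZero s
    s-nonZero = >-nonZero (<-≤-trans s₁>0 (subst (s₁ ≤_) (sym s≡) (m≤m+n s₁ s₂)))
    s₁-nonZero : NonZero s₁
    s₁-nonZero = >-nonZero s₁>0
  ks₁ : k * s₁ ≡ r * s + 1
  ks₁ = begin-equality
    k * s₁                 ≡⟨ cong (_* s₁) k≡ ⟩
    (r + r′) * s₁          ≡⟨ *-distribʳ-+ s₁ r r′ ⟩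
    r * s₁ + r′ * s₁       ≡⟨ cong (r * s₁ +_) det ⟩
    r * s₁ + (r * s₂ + 1)
      ≡⟨ solve 3 (λ r s₁ s₂ → r :* s₁ :+ (r :* s₂ :+ con 1) := r :* (s₁ :+ s₂) :+ con 1) refl r s₁ s₂ ⟩
    r * (s₁ + s₂) + 1      ≡⟨ cong (λ t → r * t + 1) s≡ ⟨
    r * s + 1              ∎
  r′s : r′ * s ≡ k * s₂ + 1
  r′s = begin-equality
    r′ * s                 ≡⟨ cong (r′ *_) s≡ ⟩
    r′ * (s₁ + s₂)         ≡⟨ *-distribˡ-+ r′ s₁ s₂ ⟩
    r′ * s₁ + r′ * s₂      ≡⟨ cong (_+ r′ * s₂) det ⟩
    r * s₂ + 1 + r′ * s₂
      ≡⟨ solve 3 (λ r r′ s₂ → r :* s₂ :+ con 1 :+ r′ :* s₂ := (r :+ r′) :* s₂ :+ con 1) refl r r′ s₂ ⟩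
    (r + r′) * s₂ + 1      ≡⟨ cong (λ t → t * s₂ + 1) k≡ ⟨
    k * s₂ + 1             ∎
  r<s₁ : r < s₁
  r<s₁ = *-cancelʳ-< s r s₁ (begin-strict
    r * s       <⟨ n<1+n (r * s) ⟩
    suc (r * s) ≡⟨ +-comm 1 (r * s) ⟩
    r * s + 1   ≡⟨ ks₁ ⟨
    k * s₁      <⟨ *-monoˡ-< s₁ k<s ⟩
    s * s₁      ≡⟨ *-comm s s₁ ⟩
    s₁ * s      ∎)
  r′≤s₂ : r′ ≤ s₂
  r′≤s₂ = *-cancelʳ-≤ r′ s₂ s (begin
    r′ * s       ≡⟨ r′s ⟩
    k * s₂ + 1   ≤⟨ +-monoʳ-≤ (k * s₂) s₂>0 ⟩
    k * s₂ + s₂  ≡⟨ +-comm (k * s₂) s₂ ⟩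
    suc k * s₂   ≤⟨ *-monoˡ-≤ s₂ k<s ⟩
    s * s₂       ≡⟨ *-comm s s₂ ⟩
    s₂ * s       ∎)

fareyParents-left : ∀ {k s s₁ r} → k < s → 0 < s₁ → s₁ < s → k * s₁ ≡ r * s + 1 → FareyParents k s
fareyParents-left {k} {s} {s₁} {r} k<s s₁>0 s₁<s ks₁ =
  complete (m≤n⇒∃[o]m+o≡n (<⇒≤ r<k)) (m≤n⇒∃[o]m+o≡n (<⇒≤ s₁<s))
  where
  instance
    s₁-nonZero : NonZero s₁
    s₁-nonZero = >-nonZero s₁>0
  r<k : r < k
  r<k = *-cancelʳ-< s₁ r k (begin-strict
    r * s₁       ≤⟨ *-monoʳ-≤ r (<⇒≤ s₁<s) ⟩
    r * s        <⟨ m<m+n (r * s) z<s ⟩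
    r * s + 1    ≡⟨ ks₁ ⟨
    k * s₁       ∎)
    where open ≤-Reasoning
  complete : ∃ (λ r′ → r + r′ ≡ k) → ∃ (λ s₂ → s₁ + s₂ ≡ s) → FareyParents k s
  complete (r′ , r+r′≡k) (s₂ , s₁+s₂≡s) =
    fareyParents-det r s₁ r′ s₂ s₁>0 s₂>0 det (sym r+r′≡k) (sym s₁+s₂≡s) k<s
    where
    open +-*-Solver using (solve; _:+_; _:*_; _:=_; con)
    s₂>0 : 0 < s₂
    s₂>0 = +-cancelˡ-< s₁ 0 s₂ (subst₂ _<_ (sym (+-identityʳ s₁)) (sym s₁+s₂≡s) s₁<s)
    det : r′ * s₁ ≡ r * s₂ + 1
    det = +-cancelˡ-≡ (r * s₁) (r′ * s₁) (r * s₂ + 1) (begin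
      r * s₁ + r′ * s₁       ≡⟨ *-distribʳ-+ s₁ r r′ ⟨
      (r + r′) * s₁          ≡⟨ cong (_* s₁) r+r′≡k ⟩
      k * s₁                 ≡⟨ ks₁ ⟩
      r * s + 1              ≡⟨ cong (λ t → r * t + 1) s₁+s₂≡s ⟨
      r * (s₁ + s₂) + 1
        ≡⟨ solve 3 (λ r s₁ s₂ → r :* (s₁ :+ s₂) :+ con 1 := r :* s₁ :+ (r :* s₂ :+ con 1)) refl r s₁ s₂ ⟩
      r * s₁ + (r * s₂ + 1)  ∎)
      where open ≡-Reasoning

fareyParents-right : ∀ {k s s₂ r′} → 0 < k → k < s → 0 < s₂ → s₂ < s → k * s₂ + 1 ≡ r′ * s → FareyParents k s
fareyParents-right {k} {s} {s₂} {r′} k>0 k<s s₂>0 s₂<s ks₂ =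
  complete (m≤n⇒∃[o]m+o≡n r′≤k) (m≤n⇒∃[o]m+o≡n (<⇒≤ s₂<s))
  where
  instance
    s-nonZero : NonZero s
    s-nonZero = >-nonZero (<-trans s₂>0 s₂<s)
  r′≤k : r′ ≤ k
  r′≤k = *-cancelʳ-≤ r′ k s (begin
    r′ * s       ≡⟨ ks₂ ⟨
    k * s₂ + 1   ≤⟨ +-monoʳ-≤ (k * s₂) k>0 ⟩
    k * s₂ + k   ≡⟨ +-comm (k * s₂) k ⟩
    k + k * s₂   ≡⟨ *-suc k s₂ ⟨
    k * suc s₂   ≤⟨ *-monoʳ-≤ k s₂<s ⟩
    k * s        ∎)
    where open ≤-Reasoning
  complete : ∃ (λ r → r′ + r ≡ k) → ∃ (λ s₁ → s₂ + s₁ ≡ s) → FareyParents k s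
  complete (r , r′+r≡k) (s₁ , s₂+s₁≡s) =
    fareyParents-det r s₁ r′ s₂ s₁>0 s₂>0 det
                     (trans (sym r′+r≡k) (+-comm r′ r)) (trans (sym s₂+s₁≡s) (+-comm s₂ s₁)) k<s
    where
    open +-*-Solver using (solve; _:+_; _:*_; _:=_; con)
    s₁>0 : 0 < s₁
    s₁>0 = +-cancelˡ-< s₂ 0 s₁ (subst₂ _<_ (sym (+-identityʳ s₂)) (sym s₂+s₁≡s) s₂<s)
    det : r′ * s₁ ≡ r * s₂ + 1
    det = +-cancelʳ-≡ (r′ * s₂) (r′ * s₁) (r * s₂ + 1) (begin
      r′ * s₁ + r′ * s₂        ≡⟨ *-distribˡ-+ r′ s₁ s₂ ⟨
      r′ * (s₁ + s₂)           ≡⟨ cong (r′ *_) (trans (+-comm s₁ s₂) s₂+s₁≡s) ⟩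
      r′ * s                   ≡⟨ ks₂ ⟨
      k * s₂ + 1               ≡⟨ cong (λ t → t * s₂ + 1) r′+r≡k ⟨
      (r′ + r) * s₂ + 1
        ≡⟨ solve 3 (λ r′ r s₂ → (r′ :+ r) :* s₂ :+ con 1 := r :* s₂ :+ con 1 :+ r′ :* s₂) refl r′ r s₂ ⟩
      r * s₂ + 1 + r′ * s₂     ∎)
      where open ≡-Reasoning

m*[n%o]%o≡m*n%o : ∀ k x s .{{_ : NonZero s}} → k * (x % s) % s ≡ k * x % s
m*[n%o]%o≡m*n%o k x s = begin
  k * (x % s) % s              ≡⟨ %-distribˡ-* k (x % s) s ⟩
  (k % s) * (x % s % s) % s    ≡⟨ cong (λ t → (k % s) * t % s) (m%n%n≡m%n x s) ⟩
  (k % s) * (x % s) % s        ≡⟨ %-distribˡ-* k x s ⟨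
  k * x % s                    ∎
  where open ≡-Reasoning

farey-parents : ∀ {k s} → 0 < k → k < s → Coprime k s → FareyParents k s
farey-parents {k} {s} k>0 k<s coprime with coprime-Bézout coprime
... | Bézout.+- x y 1+ys≡xk = fareyParents-left {r = k * s₁ / s} k<s s₁>0 (m%n<n x s) ks₁
  where
  instance
    s-nonZero : NonZero s
    s-nonZero = >-nonZero (<-trans k>0 k<s)
  s₁ : ℕ
  s₁ = x % s
  ks₁%s : k * s₁ % s ≡ 1
  ks₁%s = begin
    k * s₁ % s       ≡⟨ m*[n%o]%o≡m*n%o k x s ⟩
    k * x % s        ≡⟨ cong (_% s) (trans (*-comm k x) (sym 1+ys≡xk)) ⟩
    (1 + y * s) % s  ≡⟨ [m+kn]%n≡m%n 1 y s ⟩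
    1 % s            ≡⟨ m<n⇒m%n≡m (≤-<-trans k>0 k<s) ⟩
    1                ∎
    where open ≡-Reasoning
  ks₁ : k * s₁ ≡ (k * s₁ / s) * s + 1
  ks₁ = trans (m≡m%n+[m/n]*n (k * s₁) s) (trans (cong (_+ (k * s₁ / s) * s) ks₁%s) (+-comm 1 _))
  s₁>0 : 0 < s₁
  s₁>0 = n≢0⇒n>0 λ s₁≡0 →
    0≢1+n (trans (sym (trans (cong (k *_) s₁≡0) (*-zeroʳ k))) (trans ks₁ (+-comm (k * s₁ / s * s) 1)))
... | Bézout.-+ x y 1+xk≡ys = fareyParents-right {r′ = (1 + k * s₂) / s} k>0 k<s s₂>0 (m%n<n x s) ks₂
  where
  instance
    s-nonZero : NonZero s
    s-nonZero = >-nonZero (<-trans k>0 k<s)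
  s₂ : ℕ
  s₂ = x % s
  [1+ks₂]%s : (1 + k * s₂) % s ≡ 0
  [1+ks₂]%s = begin
    (1 + k * s₂) % s               ≡⟨ %-distribˡ-+ 1 (k * s₂) s ⟩
    (1 % s + k * s₂ % s) % s       ≡⟨ cong (λ t → (1 % s + t) % s) (m*[n%o]%o≡m*n%o k x s) ⟩
    (1 % s + k * x % s) % s        ≡⟨ %-distribˡ-+ 1 (k * x) s ⟨
    (1 + k * x) % s                ≡⟨ cong (λ t → (1 + t) % s) (*-comm k x) ⟩
    (1 + x * k) % s                ≡⟨ cong (_% s) 1+xk≡ys ⟩
    y * s % s                      ≡⟨ m*n%n≡0 y s ⟩
    0                              ∎
    where open ≡-Reasoning
  ks₂ : k * s₂ + 1 ≡ ((1 + k * s₂) / s) * s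
  ks₂ = trans (+-comm (k * s₂) 1)
              (trans (m≡m%n+[m/n]*n (1 + k * s₂) s) (cong (_+ ((1 + k * s₂) / s) * s) [1+ks₂]%s))
  s₂>0 : 0 < s₂
  s₂>0 = n≢0⇒n>0 λ s₂≡0 → <⇒≢ (≤-<-trans k>0 k<s) (sym (m*n≡1⇒n≡1 ((1 + k * s₂) / s) s (sym (begin
    1               ≡⟨ cong (_+ 1) (*-zeroʳ k) ⟨
    k * 0 + 1       ≡⟨ cong (λ t → k * t + 1) s₂≡0 ⟨
    k * s₂ + 1      ≡⟨ ks₂ ⟩
    ((1 + k * s₂) / s) * s ∎))))
    where open ≡-Reasoning

farey-induction : (P : ℕ → ℕ → Set) → P 0 1 → P 1 1 →
  (∀ {r s r′ s′} → FareyNeighbours r s r′ s′ → P r s → P r′ s′ → P (r + r′) (s + s′)) →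
  ∀ k s → 0 < s → k ≤ s → Coprime k s → P k s
farey-induction P P01 P11 mediant k s = <-rec Goal step s k
  where
  Goal : ℕ → Set
  Goal s = ∀ k → 0 < s → k ≤ s → Coprime k s → P k s
  step : ∀ s → (∀ {s′} → s′ < s → Goal s′) → Goal s
  step 1                _   zero          _ _ _        = P01
  step 1                _   (suc zero)    _ _ _        = P11
  step 1                _   (suc (suc k)) _ (s≤s ()) _
  step s@(suc (suc _)) rec zero    _ _ coprime = contradiction (coprime (divides 0 refl , ∣-refl {s})) λ ()
  step s@(suc (suc _)) rec k@(suc _) _ k≤s coprime with m≤n⇒m<n∨m≡n k≤s
  ... | inj₂ refl = contradiction (coprime (∣-refl {s} , ∣-refl)) λ ()
  ... | inj₁ k<s with farey-parents z<s k<s coprime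
  ...   | fareyParents {r} {s₁} {r′} {s₂} nb@(s₁>0 , s₂>0 , r≤s₁ , r′≤s₂ , det) k≡ s≡
    with det⇒coprime {r} {s₁} {r′} {s₂} det
  ...     | coprime₁ , coprime₂ =
    subst₂ P (sym k≡) (sym s≡) (mediant nb
      (rec (subst (s₁ <_) (sym s≡) (m<m+n s₁ s₂>0)) r s₁>0 r≤s₁ coprime₁)
      (rec (subst (s₂ <_) (sym s≡) (m<n+m s₂ s₁>0)) r′ s₂>0 r′≤s₂ coprime₂))

cohnMatrix≃wordMatrix : ∀ C → IsCFamily C →
  ∀ k s → 0 < s → k ≤ s → Coprime k s → C k s ≃ᴹ wordMatrix (word k s)
cohnMatrix≃wordMatrix C (C01 , C11 , C-mediant) = farey-induction (λ k s → C k s ≃ᴹ wordMatrix (word k s))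
  (≃ᴹ-trans (≋⇒≃ᴹ C01) (≃ᴹ-sym (⊗-identityʳ A1)))
  (≃ᴹ-trans (≋⇒≃ᴹ C11) (≃ᴹ-sym (⊗-identityʳ B1)))
  λ {r} {s} {r′} {s′} neighbours IH IH′ →
    ≃ᴹ-trans (≋⇒≃ᴹ (C-mediant r s r′ s′ neighbours))
   (≃ᴹ-trans (⊗-cong IH IH′)
   (≃ᴹ-trans (≃ᴹ-sym (wordMatrix-++ (word r s) (word r′ s′)))
             (≃ᴹ-reflexive (cong wordMatrix (sym (word-++ neighbours))))))

neighbours⇒r<s : ∀ {r s r′ s′} → FareyNeighbours r s r′ s′ → r < s
neighbours⇒r<s {r} {s} {r′} {s′} (s>0 , s′>0 , _ , r′≤s′ , det) = *-cancelʳ-< s′ r s (begin-strict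
  r * s′      <⟨ m<m+n (r * s′) z<s ⟩
  r * s′ + 1  ≡⟨ det ⟨
  r′ * s      ≤⟨ *-monoˡ-≤ s r′≤s′ ⟩
  s′ * s      ≡⟨ *-comm s′ s ⟩
  s * s′      ∎)
  where open ≤-Reasoning

neighbours⇒r′>0 : ∀ {r s r′ s′} → FareyNeighbours r s r′ s′ → 0 < r′
neighbours⇒r′>0 {r} {s} {zero} {s′} (_ , _ , _ , _ , det) = contradiction (trans det (+-comm (r * s′) 1)) 0≢1+n
neighbours⇒r′>0 {r′ = suc _} _ = z<s

word-shape : ∀ k s → 0 < s → k ≤ s → Coprime k s →
  (k < s → ∃ λ ws → word k s ≡ A ∷ ws) × (0 < k → EndsWithB (word k s))
word-shape = farey-induction Shape ((λ _ → [] , refl) , λ ()) ((λ { (s≤s ()) }) , λ _ → [B]) mediant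
  where
  Shape : ℕ → ℕ → Set
  Shape k s = (k < s → ∃ λ ws → word k s ≡ A ∷ ws) × (0 < k → EndsWithB (word k s))
  mediant : ∀ {r s r′ s′} → FareyNeighbours r s r′ s′ → Shape r s → Shape r′ s′ → Shape (r + r′) (s + s′)
  mediant {r} {s} {r′} {s′} neighbours (startsA , _) (_ , endsB)
    with startsA (neighbours⇒r<s neighbours)
  ... | ws , word≡Aws =
    (λ _ → ws ++ word r′ s′ , word≡) ,
    (λ _ → subst EndsWithB (sym word≡) (A ∷ EndsWithB-++ ws (endsB (neighbours⇒r′>0 neighbours))))
    where
    word≡ : word (r + r′) (s + s′) ≡ A ∷ ws ++ word r′ s′
    word≡ = trans (word-++ neighbours) (cong (_++ word r′ s′) word≡Aws)

word-∷ : ∀ {k s} → 0 < k → k < s → Coprime k s → ∃₂ λ w ws → word k s ≡ A ∷ w ∷ ws × EndsWithB (w ∷ ws)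
word-∷ {k} {s} k>0 k<s coprime with word-shape k s (<-trans k>0 k<s) (<⇒≤ k<s) coprime
... | startsA , endsB with startsA k<s
...   | ws , word≡Aws with subst EndsWithB word≡Aws (endsB k>0)
...     | .A ∷ [B]      = B , [] , word≡Aws , [B]
...     | .A ∷ (w ∷ e) = w , _ , word≡Aws , w ∷ e

proposition6p1 : (C : ℕ → ℕ → M2) → IsCFamily C →
    ∀ k s → 0 < k → k < s → Coprime k s →
    topRight (C k s) ≈ matchingSum (snakeGraphTilde k s)
proposition6p1 C isCFamily k s k>0 k<s coprime with word-∷ k>0 k<s coprime
... | w , ws , word≡ , endsB = ≃⇒≈ (begin
  topRight (C k s)
    ≈⟨ m12≃ (cohnMatrix≃wordMatrix C isCFamily k s (<-trans k>0 k<s) (<⇒≤ k<s) coprime) ⟩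
  topRight (wordMatrix (word k s))
    ≡⟨ cong (topRight ∘ wordMatrix) word≡ ⟩
  topRight (wordMatrix (A ∷ w ∷ ws))
    ≈⟨ topRight-wordMatrix w ws endsB ⟩
  matchingSum (map resetFirst (snakeEdges true 0 0 (A ∷ w ∷ ws)))
    ≡⟨ cong (λ u → matchingSum (map resetFirst (snakeEdges true 0 0 u))) word≡ ⟨
  matchingSum (snakeGraphTilde k s) ∎)
  where open ≃-Reasoning
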